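{- Let $k\ge1$ and for $K\ge0$ let $G_n^K(\mathbf z;q)=\sum_{\pi\in L\Pi_n^K}\big(\prod_{j}z_{|B_j|}\big)q^{rb(\pi)}$ as in the context. Then $G_0^k(\mathbf z;q)=1$ and for $n\ge1$, $G_n^k(\mathbf z;q)=\sum_{i=1}^k z_i\,G_{n-i}^k(\mathbf z q^{i};q)$; for all $m,n\ge1$, $$G_{m+n}^k(\mathbf z;q)=G_m^k(\mathbf z;q)G_n^k(\mathbf zq^m;q)+\sum_{i=2}^k\sum_{j=1}^{i-1}z_i\,q^{m-j}G_{m-j}^k(\mathbf z;q)G_{n-i+j}^k(\mathbf zq^{m+i-j};q);$$ for all $n\ge1$, $$G_n^k(\mathbf z;q)=G_n^{k-1}(\mathbf z;q)+\sum_{j=0}^{n-k}z_k\,q^{j}G_j^{k-1}(\mathbf z;q)G_{n-k-j}^k(\mathbf zq^{k+j};q);$$ and for all $n\ge1$ the $k\times k$ matrix $M$ with $M_{s,t}=G^k_{n+k-1+t-s}(\mathbf zq^{s-1};q)$ satisfies $\det M=z_k^{n+k-1}q^{\binom{n+k-1}{2}}$ if $k$ is odd and $\det M=(-1)^{n-1}z_k^{n+k-1}q^{\binom{n+k-1}{2}}$ if $k$ is even.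
   Context: A set partition of $[n]$ is written $\pi=B_1/B_2/\cdots/B_r$ with blocks ordered so that $\min B_1<\cdots<\min B_r$. It is layered if each block is a set of consecutive integers, i.e. $\pi=12\cdots i/(i+1)\cdots j/\cdots/m\cdots n$. For $K\ge0$, $L\Pi_n^K$ is the set of layered partitions of $[n]$ with all blocks of size at most $K$. The right bigger statistic $rb(\pi)$ is the number of pairs $(b,B_j)$ with $b\in B_i$ for some $i<j$ and $b<\max B_j$. $\mathbf z=(z_1,\dots,z_k)$ are indeterminates; $G_n^K(\mathbf z;q)$ is a polynomial in them and $q$, and $G_n^K(\mathbf zq^m;q)$ denotes the substitution $z_i\mapsto z_iq^m$ for all $i$. Conventions: $G_0^K=1$, $G_n^K=0$ for $n<0$. -}

module Defs where

open import Level using (Level)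
open import Data.Nat as ℕ using (ℕ; zero; suc; _≤_; _<_; _⊔_)
import Data.Nat.Properties as ℕP
open import Data.Integer as ℤ using (ℤ; +_; -[1+_])
open import Data.Fin using (Fin; zero; suc; toℕ; punchIn)
open import Data.List using (List; []; _∷_; _++_; [_]; length; concat; concatMap; filter; foldr; map)
open import Data.List.Relation.Unary.All using (All; all?)
open import Algebra.Bundles using (CommutativeRing)

-- Set partitions are represented as ordered lists of blocks
-- B₁ ∷ B₂ ∷ … (each block a list of its elements, increasing),
-- with min B₁ < min B₂ < ….

Block : Set
Block = List ℕ

Partition : Set
Partition = List Block

addToLast : ℕ → Partition → List Partition
addToLast x []           = []
addToLast x (B ∷ [])     = ((B ++ [ x ]) ∷ []) ∷ []
addToLast x (B ∷ C ∷ Bs) = map (B ∷_) (addToLast x (C ∷ Bs))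

-- All layered partitions of [n] = {1,…,n}: each block consists of
-- consecutive integers.  A layered partition of [n+1] arises uniquely
-- from one of [n] by either making n+1 a new (last) singleton block,
-- or adding n+1 to the last block.
layered : ℕ → List Partition
layered zero    = [] ∷ []
layered (suc n) = concatMap (λ π → (π ++ [ [ suc n ] ]) ∷ addToLast (suc n) π) (layered n)

LΠ : ℕ → ℕ → List Partition
LΠ n K = filter (all? (λ B → length B ℕ.≤? K)) (layered n)

maxL : List ℕ → ℕ
maxL = foldr _⊔_ 0

countBelow : ℕ → List ℕ → ℕ
countBelow m xs = length (filter (λ b → b ℕ.<? m) xs)

-- rb: number of pairs (b, B_j) with b ∈ B_i for some i < j and b < max B_j.
-- rbAux E Bs : E = blocks already passed (B_1 … B_{j-1}), Bs = remaining.
rbAux : Partition → Partition → ℕ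
rbAux E []       = 0
rbAux E (B ∷ Bs) = countBelow (maxL B) (concat E) ℕ.+ rbAux (E ++ [ B ]) Bs

rb : Partition → ℕ
rb π = rbAux [] π

-- Ring-valued definitions, for an arbitrary commutative ring R.
-- (Polynomial identities in ℤ[z₁,…,z_k,q] are stated as identities
--  holding for all values z, q in all commutative rings.)

module WithRing {c ℓ : Level} (R : CommutativeRing c ℓ) where
  open CommutativeRing R using (Carrier; _+_; _*_; -_; 0#; 1#)

  pow : Carrier → ℕ → Carrier
  pow x zero    = 1#
  pow x (suc n) = x * pow x n

  sumN : ℕ → (ℕ → Carrier) → Carrier
  sumN zero    f = 0#
  sumN (suc n) f = f 0 + sumN n (λ i → f (suc i))

  sumL : List Carrier → Carrier
  sumL = foldr _+_ 0#

  prodL : List Carrier → Carrier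
  prodL = foldr _*_ 1#

  -- substitution z_i ↦ z_i t  (used as  z q^m  ↦  scale z (pow q m))
  scale : (ℕ → Carrier) → Carrier → (ℕ → Carrier)
  scale z t i = z i * t

  G : ℕ → ℕ → (ℕ → Carrier) → Carrier → Carrier
  G K n z q = sumL (map (λ π → prodL (map (λ B → z (length B)) π) * pow q (rb π)) (LΠ n K))

  Gℤ : ℕ → ℤ → (ℕ → Carrier) → Carrier → Carrier
  Gℤ K (+ n)    z q = G K n z q
  Gℤ K -[1+ n ] z q = 0#

  sumFin : ∀ n → (Fin n → Carrier) → Carrier
  sumFin zero    f = 0#
  sumFin (suc n) f = f zero + sumFin n (λ i → f (suc i))

  det : ∀ n → (Fin n → Fin n → Carrier) → Carrier
  det zero    M = 1#
  det (suc n) M = sumFin (suc n) (λ j →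
    pow (- 1#) (toℕ j) * (M zero j * det n (λ r s → M (suc r) (punchIn j s))))

-- A layered partition is determined by its sequence of block sizes, and its
-- rb is the sum over blocks of the number of earlier elements (Compositions).
-- So G is a sum over compositions of a weight that factorises block by
-- block, and removing the first or the last block gives the two basic
-- recursions G-byFirstBlock and G-byLastBlock (GeneratingFunction).  The
-- recurrence is the first of them; the convolution and refinement identities
-- follow from them by induction on m resp. n.  For the determinant, general
-- properties of the first-row expansion `det` (Determinants) show that
-- expanding the first row by the first-block recursion turns the matrix for
-- N+1 into the one for N with z ↦ zq, at the cost of a factor (−1)^{k−1} z_k;
-- for N = 0 the matrix is unitriangular.

module Submission where

open import Defs
open import Data.Nat using (ℕ; suc; _≤_; _∸_; z≤n; s≤s) renaming (_+_ to _+ℕ_; _*_ to _*ℕ_)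
open import Relation.Binary.PropositionalEquality using (_≡_)
open import Algebra.Bundles using (CommutativeRing)

module Compositions where
  open import Data.Nat using (ℕ; zero; suc; _+_; _*_; _<_; _≤_; s≤s; _<?_)
  import Data.Nat.Properties as ℕP
  open import Data.Nat.Tactic.RingSolver using (solve-∀)
  open import Data.List using (List; []; _∷_; _++_; [_]; map; concat; concatMap; length)
  import Data.List.Properties as ListP
  open import Data.List.Relation.Unary.All as All using (All; []; _∷_)
  import Data.List.Relation.Unary.All.Properties as AllP
  open import Function using (_∘_)
  open import Relation.Binary.PropositionalEquality
    using (_≡_; _≢_; refl; sym; trans; cong; cong₂; subst; module ≡-Reasoning)

  -- A composition is the list of block sizes of a layered partition, each
  -- part stored as (size − 1) so that every list of naturals is valid.

  size : List ℕ → ℕ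
  size []      = 0
  size (p ∷ c) = suc p + size c

  growLast : List ℕ → List (List ℕ)
  growLast []           = []
  growLast (p ∷ [])     = (suc p ∷ []) ∷ []
  growLast (p ∷ p' ∷ c) = map (p ∷_) (growLast (p' ∷ c))

  -- The two ways to pass from a composition of n to one of n+1: open a new
  -- block of size one, or enlarge the last block (mirroring `layered`).
  extend : List ℕ → List (List ℕ)
  extend c = (c ++ [ 0 ]) ∷ growLast c

  compositions : ℕ → List (List ℕ)
  compositions zero    = [] ∷ []
  compositions (suc n) = concatMap extend (compositions n)

  -- interval o p = [o+1, o+2, …, o+p+1], the block of p+1 integers after o.
  interval : ℕ → ℕ → List ℕ
  interval o zero    = suc o ∷ []
  interval o (suc p) = suc o ∷ interval (suc o) p

  blocksFrom : ℕ → List ℕ → Partition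
  blocksFrom o []      = []
  blocksFrom o (p ∷ c) = interval o p ∷ blocksFrom (o + suc p) c

  -- rb of a layered partition: every block B_j is bigger than all e elements
  -- of the earlier blocks, so it contributes e.
  rbComp : ℕ → List ℕ → ℕ
  rbComp e []      = 0
  rbComp e (p ∷ c) = e + rbComp (e + suc p) c

  size-++ : ∀ c d → size (c ++ d) ≡ size c + size d
  size-++ []      d = refl
  size-++ (p ∷ c) d = trans (cong (suc p +_) (size-++ c d)) (sym (ℕP.+-assoc (suc p) (size c) (size d)))

  size-growLast : ∀ c → All (λ d → size d ≡ suc (size c)) (growLast c)
  size-growLast []           = []
  size-growLast (p ∷ [])     = refl ∷ []
  size-growLast (p ∷ p' ∷ c) =
    AllP.map⁺ (All.map (λ e → trans (cong (suc p +_) e) (ℕP.+-suc (suc p) (size (p' ∷ c))))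
                       (size-growLast (p' ∷ c)))

  compositions-size : ∀ n → All (λ c → size c ≡ n) (compositions n)
  compositions-size zero    = refl ∷ []
  compositions-size (suc n) = AllP.concat⁺ (AllP.map⁺ (All.map extend-size (compositions-size n)))
    where
    extend-size : ∀ {c} → size c ≡ n → All (λ d → size d ≡ suc n) (extend c)
    extend-size {c} e = trans (size-++ c [ 0 ]) (trans (ℕP.+-comm (size c) 1) (cong suc e))
                      ∷ All.map (λ e' → trans e' (cong suc e)) (size-growLast c)

  compositions-nonempty : ∀ n → All (_≢ []) (compositions (suc n))
  compositions-nonempty n = AllP.concat⁺ (AllP.map⁺ (All.universal extend-nonempty (compositions n)))
    where
    growLast-nonempty : ∀ c → All (_≢ []) (growLast c)
    growLast-nonempty []           = []
    growLast-nonempty (p ∷ [])     = (λ ()) ∷ []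
    growLast-nonempty (p ∷ p' ∷ c) = AllP.map⁺ (All.universal (λ d ()) (growLast (p' ∷ c)))
    extend-nonempty : ∀ c → All (_≢ []) (extend c)
    extend-nonempty []      = (λ ()) ∷ []
    extend-nonempty (p ∷ c) = (λ ()) ∷ growLast-nonempty (p ∷ c)

  growLast-cons : ∀ a c → c ≢ [] → growLast (a ∷ c) ≡ map (a ∷_) (growLast c)
  growLast-cons a []      c≢[] with () ← c≢[] refl
  growLast-cons a (p ∷ c) _    = refl

  growLast-snoc : ∀ c a → growLast (c ++ [ a ]) ≡ (c ++ [ suc a ]) ∷ []
  growLast-snoc []           a = refl
  growLast-snoc (p ∷ [])     a = refl
  growLast-snoc (p ∷ p' ∷ c) a = cong (map (p ∷_)) (growLast-snoc (p' ∷ c) a)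

  interval-snoc : ∀ o p → interval o p ++ [ suc (o + suc p) ] ≡ interval o (suc p)
  interval-snoc o zero    = cong (λ x → suc o ∷ suc x ∷ []) (ℕP.+-comm o 1)
  interval-snoc o (suc p) = cong (suc o ∷_)
    (trans (cong (λ x → interval (suc o) p ++ [ suc x ]) (ℕP.+-suc o (suc p))) (interval-snoc (suc o) p))

  blocksFrom-snoc : ∀ o c → blocksFrom o (c ++ [ 0 ]) ≡ blocksFrom o c ++ [ [ suc (o + size c) ] ]
  blocksFrom-snoc o []      = cong (λ x → [ suc x ] ∷ []) (sym (ℕP.+-identityʳ o))
  blocksFrom-snoc o (p ∷ c) = cong (interval o p ∷_) (trans (blocksFrom-snoc (o + suc p) c)
    (cong (λ x → blocksFrom (o + suc p) c ++ [ [ suc x ] ]) (ℕP.+-assoc o (suc p) (size c))))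

  blocksFrom-growLast : ∀ o c → addToLast (suc (o + size c)) (blocksFrom o c) ≡ map (blocksFrom o) (growLast c)
  blocksFrom-growLast o []           = refl
  blocksFrom-growLast o (p ∷ [])     = cong (λ B → (B ∷ []) ∷ [])
    (trans (cong (λ x → interval o p ++ [ suc (o + x) ]) (ℕP.+-identityʳ (suc p))) (interval-snoc o p))
  blocksFrom-growLast o (p ∷ p' ∷ c) = begin
    map (interval o p ∷_) (addToLast (suc (o + (suc p + size (p' ∷ c)))) (blocksFrom (o + suc p) (p' ∷ c)))
      ≡⟨ cong (λ x → map (interval o p ∷_) (addToLast (suc x) (blocksFrom (o + suc p) (p' ∷ c))))
              (sym (ℕP.+-assoc o (suc p) (size (p' ∷ c)))) ⟩
    map (interval o p ∷_) (addToLast (suc (o + suc p + size (p' ∷ c))) (blocksFrom (o + suc p) (p' ∷ c)))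
      ≡⟨ cong (map (interval o p ∷_)) (blocksFrom-growLast (o + suc p) (p' ∷ c)) ⟩
    map (interval o p ∷_) (map (blocksFrom (o + suc p)) (growLast (p' ∷ c)))
      ≡⟨ sym (ListP.map-∘ (growLast (p' ∷ c))) ⟩
    map (λ d → interval o p ∷ blocksFrom (o + suc p) d) (growLast (p' ∷ c))
      ≡⟨ ListP.map-∘ (growLast (p' ∷ c)) ⟩
    map (blocksFrom o) (map (p ∷_) (growLast (p' ∷ c))) ∎
    where open ≡-Reasoning

  layered≡compositions : ∀ n → layered n ≡ map (blocksFrom 0) (compositions n)
  layered≡compositions zero    = refl
  layered≡compositions (suc n) = begin
    concatMap newElement (layered n)
      ≡⟨ cong (concatMap newElement) (layered≡compositions n) ⟩
    concatMap newElement (map (blocksFrom 0) (compositions n))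
      ≡⟨ cong concat (sym (ListP.map-∘ (compositions n))) ⟩
    concat (map (newElement ∘ blocksFrom 0) (compositions n))
      ≡⟨ cong concat (ListP.map-cong-local (All.map agree (compositions-size n))) ⟩
    concat (map (map (blocksFrom 0) ∘ extend) (compositions n))
      ≡⟨ cong concat (ListP.map-∘ (compositions n)) ⟩
    concat (map (map (blocksFrom 0)) (map extend (compositions n)))
      ≡⟨ ListP.concat-map (map extend (compositions n)) ⟩
    map (blocksFrom 0) (compositions (suc n)) ∎
    where
    open ≡-Reasoning
    newElement : Partition → List Partition
    newElement π = (π ++ [ [ suc n ] ]) ∷ addToLast (suc n) π
    agree : ∀ {c} → size c ≡ n → newElement (blocksFrom 0 c) ≡ map (blocksFrom 0) (extend c)
    agree {c} refl = cong₂ _∷_ (sym (blocksFrom-snoc 0 c)) (blocksFrom-growLast 0 c)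

  length-interval : ∀ o p → length (interval o p) ≡ suc p
  length-interval o zero    = refl
  length-interval o (suc p) = cong suc (length-interval (suc o) p)

  interval-≤ : ∀ o p → All (_≤ o + suc p) (interval o p)
  interval-≤ o zero    = ℕP.≤-reflexive (ℕP.+-comm 1 o) ∷ []
  interval-≤ o (suc p) = subst (λ x → All (_≤ x) (interval o (suc p))) (sym (ℕP.+-suc o (suc p)))
    (s≤s (ℕP.m≤m+n o (suc p)) ∷ interval-≤ (suc o) p)

  interval-max : ∀ o p → suc o ≤ maxL (interval o p)
  interval-max o zero    = ℕP.m≤m⊔n (suc o) 0
  interval-max o (suc p) = ℕP.m≤m⊔n (suc o) (maxL (interval (suc o) p))

  countBelow-all : ∀ m xs → All (_< m) xs → countBelow m xs ≡ length xs
  countBelow-all m xs xs<m = cong length (ListP.filter-all (_<? m) xs<m)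

  rb-blocksFrom : ∀ E o c → All (_≤ o) (concat E) → rbAux E (blocksFrom o c) ≡ rbComp (length (concat E)) c
  rb-blocksFrom E o []      E≤o = refl
  rb-blocksFrom E o (p ∷ c) E≤o = cong₂ _+_
    (countBelow-all (maxL (interval o p)) (concat E)
      (All.map (λ x≤o → ℕP.≤-trans (s≤s x≤o) (interval-max o p)) E≤o))
    (trans (rb-blocksFrom (E ++ [ interval o p ]) (o + suc p) c E'≤o')
           (cong (λ x → rbComp x c)
             (trans (cong length concat-E') (trans (ListP.length-++ (concat E))
                    (cong (length (concat E) +_) (length-interval o p))))))
    where
    concat-E' : concat (E ++ [ interval o p ]) ≡ concat E ++ interval o p
    concat-E' = trans (sym (ListP.concat-++ E [ interval o p ])) (cong (concat E ++_) (ListP.++-identityʳ (interval o p)))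
    E'≤o' : All (_≤ o + suc p) (concat (E ++ [ interval o p ]))
    E'≤o' = subst (All (_≤ o + suc p)) (sym concat-E')
      (AllP.++⁺ (All.map (λ x≤o → ℕP.≤-trans x≤o (ℕP.m≤m+n o (suc p))) E≤o) (interval-≤ o p))

  -- A new last block of the composition sees all size c earlier elements.
  rbComp-snoc : ∀ e c a → rbComp e (c ++ [ a ]) ≡ rbComp e c + (e + size c)
  rbComp-snoc e []      a = refl
  rbComp-snoc e (p ∷ c) a = trans (cong (e +_) (rbComp-snoc (e + suc p) c a))
    (rearrange e (rbComp (e + suc p) c) (suc p) (size c))
    where
    rearrange : ∀ e r s t → e + (r + (e + s + t)) ≡ e + r + (e + (s + t))
    rearrange = solve-∀

  -- Shifting all elements by e adds e to the contribution of every block.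
  rbComp-shift : ∀ e c → rbComp e c ≡ rbComp 0 c + e * length c
  rbComp-shift e []      = sym (ℕP.*-zeroʳ e)
  rbComp-shift e (p ∷ c) = trans (cong (e +_) (rbComp-shift (e + suc p) c))
    (trans (rearrange e (rbComp 0 c) (suc p) (length c))
           (cong (_+ e * suc (length c)) (sym (rbComp-shift (suc p) c))))
    where
    rearrange : ∀ e r s l → e + (r + (e + s) * l) ≡ r + s * l + e * suc l
    rearrange = solve-∀

module Parity where
  open import Data.Nat using (zero; _+_; _*_; _%_)
  open import Data.Nat.DivMod using ([m+kn]%n≡m%n)
  open import Data.Nat.Tactic.RingSolver using (solve-∀)
  import Data.Nat.Properties as ℕP
  open import Data.Product using (∃; _,_)
  open import Data.Sum using (_⊎_; inj₁; inj₂)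
  open import Relation.Binary.PropositionalEquality using (refl; cong; trans; sym)

  even-or-odd : ∀ m → (∃ λ h → m ≡ h + h) ⊎ (∃ λ h → m ≡ suc (h + h))
  even-or-odd zero    = inj₁ (0 , refl)
  even-or-odd (suc m) with even-or-odd m
  ... | inj₁ (h , m≡h+h)     = inj₂ (h , cong suc m≡h+h)
  ... | inj₂ (h , m≡1+h+h)   = inj₁ (suc h , trans (cong suc m≡1+h+h) (cong suc (sym (ℕP.+-suc h h))))

  odd%2 : ∀ h → suc (h + h) % 2 ≡ 1
  odd%2 h = trans (cong (_% 2) (double h)) ([m+kn]%n≡m%n 1 h 2)
    where
    double : ∀ h → suc (h + h) ≡ 1 + h * 2
    double = solve-∀

  even%2 : ∀ h → suc (suc (h + h)) % 2 ≡ 0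
  even%2 h = trans (cong (_% 2) (double h)) ([m+kn]%n≡m%n 0 (suc h) 2)
    where
    double : ∀ h → suc (suc (h + h)) ≡ 0 + suc h * 2
    double = solve-∀

module RingFacts {c ℓ} (R : CommutativeRing c ℓ) where
  open CommutativeRing R hiding (zero)
  open WithRing R
  open import Data.Nat using (zero; _<_; _<ᵇ_; _⊓_)
  import Data.Nat.Properties as ℕP
  import Data.List.Properties as ListP
  open import Data.Bool using (Bool; true; false; if_then_else_)
  open import Data.List using (List; []; _∷_; _++_; map; concatMap; filter)
  open import Data.List.Relation.Unary.All using (All; []; _∷_)
  open import Relation.Nullary using (does)
  open import Relation.Unary using (Pred; Decidable)
  import Level
  import Relation.Binary.PropositionalEquality as ≡
  open import Relation.Binary.Reasoning.Setoid setoid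
  open import Algebra.Properties.CommutativeSemiring.Exp commutativeSemiring
    using (_^_; ^-congˡ; ^-homo-*; ^-assocʳ; ^-distrib-*)
  open import Algebra.Properties.CommutativeSemigroup +-commutativeSemigroup using (interchange)
  open import Algebra.Properties.Ring ring using (-1*x≈-x)
  open import Algebra.Properties.Group +-group using (⁻¹-involutive)
  open import Data.Nat using (_%_; _≡ᵇ_)
  open import Data.Product using (_,_)
  open import Data.Sum using (inj₁; inj₂)
  open Parity

  pow≡^ : ∀ x n → pow x n ≡ x ^ n
  pow≡^ x zero    = ≡.refl
  pow≡^ x (suc n) = ≡.cong (x *_) (pow≡^ x n)

  pow-cong : ∀ {x y} n → x ≈ y → pow x n ≈ pow y n
  pow-cong {x} {y} n x≈y = begin
    pow x n ≡⟨ pow≡^ x n ⟩ x ^ n ≈⟨ ^-congˡ n x≈y ⟩ y ^ n ≡⟨ pow≡^ y n ⟨ pow y n ∎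

  pow-+ : ∀ x m n → pow x (m +ℕ n) ≈ pow x m * pow x n
  pow-+ x m n = begin
    pow x (m +ℕ n)    ≡⟨ pow≡^ x (m +ℕ n) ⟩
    x ^ (m +ℕ n)      ≈⟨ ^-homo-* x m n ⟩
    x ^ m * x ^ n     ≡⟨ ≡.cong₂ _*_ (pow≡^ x m) (pow≡^ x n) ⟨
    pow x m * pow x n ∎

  pow-* : ∀ x m n → pow x (m *ℕ n) ≈ pow (pow x m) n
  pow-* x m n = begin
    pow x (m *ℕ n) ≡⟨ pow≡^ x (m *ℕ n) ⟩
    x ^ (m *ℕ n)   ≈⟨ ^-assocʳ x m n ⟨
    (x ^ m) ^ n    ≡⟨ ≡.trans (≡.cong (λ y → pow y n) (pow≡^ x m)) (pow≡^ (x ^ m) n) ⟨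
    pow (pow x m) n ∎

  pow-*-distrib : ∀ x y n → pow (x * y) n ≈ pow x n * pow y n
  pow-*-distrib x y n = begin
    pow (x * y) n     ≡⟨ pow≡^ (x * y) n ⟩
    (x * y) ^ n       ≈⟨ ^-distrib-* x y n ⟩
    x ^ n * y ^ n     ≡⟨ ≡.cong₂ _*_ (pow≡^ x n) (pow≡^ y n) ⟨
    pow x n * pow y n ∎

  -1²≈1 : - 1# * - 1# ≈ 1#
  -1²≈1 = trans (-1*x≈-x (- 1#)) (⁻¹-involutive 1#)

  -1^even : ∀ h → pow (- 1#) (h +ℕ h) ≈ 1#
  -1^even zero    = refl
  -1^even (suc h) = begin
    - 1# * pow (- 1#) (h +ℕ suc h)   ≡⟨ ≡.cong (λ e → - 1# * pow (- 1#) e) (ℕP.+-suc h h) ⟩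
    - 1# * (- 1# * pow (- 1#) (h +ℕ h)) ≈⟨ *-assoc _ _ _ ⟨
    (- 1# * - 1#) * pow (- 1#) (h +ℕ h) ≈⟨ *-cong -1²≈1 (-1^even h) ⟩
    1# * 1#                          ≈⟨ *-identityˡ 1# ⟩
    1#                               ∎

  alternating-power : ∀ k' n' x → pow (pow (- 1#) k' * x) (suc n' +ℕ k')
    ≈ (if suc k' % 2 ≡ᵇ 1 then pow x (suc n' +ℕ k') else pow (- 1#) n' * pow x (suc n' +ℕ k'))
  alternating-power k' n' x with even-or-odd k'
  ... | inj₁ (h , ≡.refl) rewrite odd%2 h = pow-cong (suc n' +ℕ (h +ℕ h)) (trans (*-cong (-1^even h) refl) (*-identityˡ x))
  ... | inj₂ (h , ≡.refl) rewrite even%2 h = begin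
    pow (- 1# * pow (- 1#) (h +ℕ h) * x) N ≈⟨ pow-cong N (*-cong (trans (*-cong refl (-1^even h)) (*-identityʳ (- 1#))) refl) ⟩
    pow (- 1# * x) N                       ≈⟨ pow-*-distrib (- 1#) x N ⟩
    pow (- 1#) N * pow x N                 ≡⟨ ≡.cong (λ e → pow (- 1#) e * pow x N) N≡n'+even ⟩
    pow (- 1#) (n' +ℕ (suc h +ℕ suc h)) * pow x N
      ≈⟨ *-cong (trans (pow-+ (- 1#) n' (suc h +ℕ suc h)) (trans (*-cong refl (-1^even (suc h))) (*-identityʳ _))) refl ⟩
    pow (- 1#) n' * pow x N                ∎
    where
    N = suc n' +ℕ suc (h +ℕ h)
    N≡n'+even : N ≡ n' +ℕ (suc h +ℕ suc h)
    N≡n'+even = ≡.trans (≡.sym (ℕP.+-suc n' (suc (h +ℕ h)))) (≡.cong (λ y → n' +ℕ suc y) (≡.sym (ℕP.+-suc h h)))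

  if-* : ∀ (b : Bool) x y → (if b then x else 0#) * y ≈ (if b then x * y else 0#)
  if-* true  x y = refl
  if-* false x y = zeroˡ y

  *-if : ∀ (b : Bool) x y → x * (if b then y else 0#) ≈ (if b then x * y else 0#)
  *-if true  x y = refl
  *-if false x y = zeroʳ x

  zeroʳ³ : ∀ x y u → x * (y * (u * 0#)) ≈ 0#
  zeroʳ³ x y u = trans (*-cong refl (trans (*-cong refl (zeroʳ u)) (zeroʳ y))) (zeroʳ x)

  if-cong : ∀ (b : Bool) {x y} → x ≈ y → (if b then x else 0#) ≈ (if b then y else 0#)
  if-cong true  x≈y = x≈y
  if-cong false x≈y = refl

  sumN-cong : ∀ n {f g : ℕ → Carrier} → (∀ i → f i ≈ g i) → sumN n f ≈ sumN n g
  sumN-cong zero    f≈g = refl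
  sumN-cong (suc n) f≈g = +-cong (f≈g 0) (sumN-cong n (λ i → f≈g (suc i)))

  sumN-cong< : ∀ n {f g : ℕ → Carrier} → (∀ i → i < n → f i ≈ g i) → sumN n f ≈ sumN n g
  sumN-cong< zero    f≈g = refl
  sumN-cong< (suc n) f≈g = +-cong (f≈g 0 (s≤s z≤n)) (sumN-cong< n (λ i i<n → f≈g (suc i) (s≤s i<n)))

  sumN-zero : ∀ n {f : ℕ → Carrier} → (∀ i → f i ≈ 0#) → sumN n f ≈ 0#
  sumN-zero zero    f≈0 = refl
  sumN-zero (suc n) f≈0 = trans (+-cong (f≈0 0) (sumN-zero n (λ i → f≈0 (suc i)))) (+-identityʳ 0#)

  sumN-+ : ∀ n (f g : ℕ → Carrier) → sumN n (λ i → f i + g i) ≈ sumN n f + sumN n g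
  sumN-+ zero    f g = sym (+-identityʳ 0#)
  sumN-+ (suc n) f g = trans (+-cong refl (sumN-+ n (λ i → f (suc i)) (λ i → g (suc i)))) (interchange _ _ _ _)

  sumN-*ˡ : ∀ n x (f : ℕ → Carrier) → x * sumN n f ≈ sumN n (λ i → x * f i)
  sumN-*ˡ zero    x f = zeroʳ x
  sumN-*ˡ (suc n) x f = trans (distribˡ x _ _) (+-cong refl (sumN-*ˡ n x (λ i → f (suc i))))

  sumN-*ʳ : ∀ n x (f : ℕ → Carrier) → sumN n f * x ≈ sumN n (λ i → f i * x)
  sumN-*ʳ zero    x f = zeroˡ x
  sumN-*ʳ (suc n) x f = trans (distribʳ x _ _) (+-cong refl (sumN-*ʳ n x (λ i → f (suc i))))

  sumN-last : ∀ n (f : ℕ → Carrier) → sumN (suc n) f ≈ sumN n f + f n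
  sumN-last zero    f = trans (+-identityʳ _) (sym (+-identityˡ _))
  sumN-last (suc n) f = trans (+-cong refl (sumN-last n (λ i → f (suc i)))) (sym (+-assoc _ _ _))

  sumN-swap : ∀ n m (f : ℕ → ℕ → Carrier) →
              sumN n (λ i → sumN m (λ j → f i j)) ≈ sumN m (λ j → sumN n (λ i → f i j))
  sumN-swap zero    m f = sym (sumN-zero m (λ _ → refl))
  sumN-swap (suc n) m f = trans (+-cong refl (sumN-swap n m (λ i → f (suc i))))
                                (sym (sumN-+ m (f 0) (λ j → sumN n (λ i → f (suc i) j))))

  sumN-extend : ∀ M N {f g : ℕ → Carrier} → M ≤ N → (∀ j → j < M → f j ≈ g j) →
                (∀ j → M ≤ j → g j ≈ 0#) → sumN M f ≈ sumN N g
  sumN-extend zero    N       _         _   g≈0 = sym (sumN-zero N (λ j → g≈0 j z≤n))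
  sumN-extend (suc M) (suc N) (s≤s M≤N) f≈g g≈0 = +-cong (f≈g 0 (s≤s z≤n))
    (sumN-extend M N M≤N (λ j j<M → f≈g (suc j) (s≤s j<M)) (λ j M≤j → g≈0 (suc j) (s≤s M≤j)))

  sumN-guard : ∀ N K (h : ℕ → Carrier) → sumN N (λ a → if a <ᵇ K then h a else 0#) ≈ sumN (N ⊓ K) h
  sumN-guard zero    K       h = refl
  sumN-guard (suc N) zero    h = sumN-zero (suc N) (λ _ → refl)
  sumN-guard (suc N) (suc K) h = +-cong refl (sumN-guard N K (λ a → h (suc a)))

  sumN-guard-swap : ∀ N K (h : ℕ → Carrier) →
    sumN N (λ a → if a <ᵇ K then h a else 0#) ≈ sumN K (λ a → if a <ᵇ N then h a else 0#)
  sumN-guard-swap N K h = begin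
    sumN N (λ a → if a <ᵇ K then h a else 0#) ≈⟨ sumN-guard N K h ⟩
    sumN (N ⊓ K) h                            ≡⟨ ≡.cong (λ x → sumN x h) (ℕP.⊓-comm N K) ⟩
    sumN (K ⊓ N) h                            ≈⟨ sumN-guard K N h ⟨
    sumN K (λ a → if a <ᵇ N then h a else 0#) ∎

  sumOver : {A : Set} → List A → (A → Carrier) → Carrier
  sumOver L f = sumL (map f L)

  sumOver-cong : {A : Set} (L : List A) {f g : A → Carrier} → (∀ x → f x ≈ g x) → sumOver L f ≈ sumOver L g
  sumOver-cong []      f≈g = refl
  sumOver-cong (x ∷ L) f≈g = +-cong (f≈g x) (sumOver-cong L f≈g)

  sumOver-congᴬ : {A : Set} {P : A → Set} {L : List A} {f g : A → Carrier} →
                  All P L → (∀ x → P x → f x ≈ g x) → sumOver L f ≈ sumOver L g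
  sumOver-congᴬ []         f≈g = refl
  sumOver-congᴬ (px ∷ pxs) f≈g = +-cong (f≈g _ px) (sumOver-congᴬ pxs f≈g)

  sumOver-++ : {A : Set} (L M : List A) (f : A → Carrier) → sumOver (L ++ M) f ≈ sumOver L f + sumOver M f
  sumOver-++ []      M f = sym (+-identityˡ _)
  sumOver-++ (x ∷ L) M f = trans (+-cong refl (sumOver-++ L M f)) (sym (+-assoc _ _ _))

  sumOver-concatMap : {A B : Set} (g : A → List B) (L : List A) (f : B → Carrier) →
                      sumOver (concatMap g L) f ≈ sumOver L (λ x → sumOver (g x) f)
  sumOver-concatMap g []      f = refl
  sumOver-concatMap g (x ∷ L) f = trans (sumOver-++ (g x) (concatMap g L) f) (+-cong refl (sumOver-concatMap g L f))

  sumOver-map : {A B : Set} (h : A → B) (L : List A) (f : B → Carrier) → sumOver (map h L) f ≡ sumOver L (λ x → f (h x))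
  sumOver-map h L f = ≡.cong sumL (≡.sym (ListP.map-∘ L))

  sumOver-+ : {A : Set} (L : List A) (f g : A → Carrier) → sumOver L (λ x → f x + g x) ≈ sumOver L f + sumOver L g
  sumOver-+ []      f g = sym (+-identityʳ 0#)
  sumOver-+ (x ∷ L) f g = trans (+-cong refl (sumOver-+ L f g)) (interchange _ _ _ _)

  sumOver-*ˡ : ∀ {A : Set} (L : List A) x (f : A → Carrier) → x * sumOver L f ≈ sumOver L (λ y → x * f y)
  sumOver-*ˡ []      x f = zeroʳ x
  sumOver-*ˡ (y ∷ L) x f = trans (distribˡ x _ _) (+-cong refl (sumOver-*ˡ L x f))

  sumOver-*ʳ : ∀ {A : Set} (L : List A) x (f : A → Carrier) → sumOver L f * x ≈ sumOver L (λ y → f y * x)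
  sumOver-*ʳ []      x f = zeroˡ x
  sumOver-*ʳ (y ∷ L) x f = trans (distribʳ x _ _) (+-cong refl (sumOver-*ʳ L x f))

  sumOver-filter : {A : Set} {P : Pred A Level.zero} (P? : Decidable P) (L : List A) (f : A → Carrier) →
                   sumOver (filter P? L) f ≈ sumOver L (λ x → if does (P? x) then f x else 0#)
  sumOver-filter P? []      f = refl
  sumOver-filter P? (x ∷ L) f with does (P? x)
  ... | true  = +-cong refl (sumOver-filter P? L f)
  ... | false = trans (sumOver-filter P? L f) (sym (+-identityˡ _))

module Determinants {c ℓ} (R : CommutativeRing c ℓ) where
  open CommutativeRing R hiding (zero)
  open WithRing R
  open RingFacts R
  open import Data.Nat using (zero; _<_)
  open import Data.Fin using (Fin; zero; suc; toℕ; punchIn)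
  import Relation.Binary.PropositionalEquality as ≡
  open import Relation.Binary.Reasoning.Setoid setoid
  open import Algebra.Properties.Ring ring using (-1*x≈-x)
  open import Algebra.Properties.Group +-group using (inverseʳ-unique; ε⁻¹≈ε)
  open import Algebra.Properties.CommutativeSemigroup +-commutativeSemigroup using (interchange)
  -- normalisation of products (the solver writes ⊕ for the monoid operation _*_)
  open import Algebra.Solver.CommutativeMonoid *-commutativeMonoid using (_⊕_; _⊜_) renaming (solve to *-solve)

  Matrix : ℕ → ℕ → Set c
  Matrix m n = Fin m → Fin n → Carrier

  sign : ∀ {n} → Fin n → Carrier
  sign j = pow (- 1#) (toℕ j)

  x-x≈0 : ∀ x → x + - 1# * x ≈ 0#
  x-x≈0 x = trans (+-cong refl (-1*x≈-x x)) (-‿inverseʳ x)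

  sumFin-cong : ∀ n {f g : Fin n → Carrier} → (∀ i → f i ≈ g i) → sumFin n f ≈ sumFin n g
  sumFin-cong zero    f≈g = refl
  sumFin-cong (suc n) f≈g = +-cong (f≈g zero) (sumFin-cong n (λ i → f≈g (suc i)))

  sumFin-zero : ∀ n {f : Fin n → Carrier} → (∀ i → f i ≈ 0#) → sumFin n f ≈ 0#
  sumFin-zero zero    f≈0 = refl
  sumFin-zero (suc n) f≈0 = trans (+-cong (f≈0 zero) (sumFin-zero n (λ i → f≈0 (suc i)))) (+-identityʳ 0#)

  sumFin-+ : ∀ n (f g : Fin n → Carrier) → sumFin n (λ i → f i + g i) ≈ sumFin n f + sumFin n g
  sumFin-+ zero    f g = sym (+-identityʳ 0#)
  sumFin-+ (suc n) f g = trans (+-cong refl (sumFin-+ n (λ i → f (suc i)) (λ i → g (suc i)))) (interchange _ _ _ _)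

  sumFin-*ˡ : ∀ n x (f : Fin n → Carrier) → x * sumFin n f ≈ sumFin n (λ i → x * f i)
  sumFin-*ˡ zero    x f = zeroʳ x
  sumFin-*ˡ (suc n) x f = trans (distribˡ x _ _) (+-cong refl (sumFin-*ˡ n x (λ i → f (suc i))))

  sumFin-sumN : ∀ n K (f : Fin n → ℕ → Carrier) →
                sumFin n (λ j → sumN K (f j)) ≈ sumN K (λ a → sumFin n (λ j → f j a))
  sumFin-sumN zero    K f = sym (sumN-zero K (λ _ → refl))
  sumFin-sumN (suc n) K f = trans (+-cong refl (sumFin-sumN n K (λ j → f (suc j))))
                                  (sym (sumN-+ K (f zero) (λ a → sumFin n (λ j → f (suc j) a))))

  det-cong : ∀ n {M M' : Matrix n n} → (∀ r s → M r s ≈ M' r s) → det n M ≈ det n M'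
  det-cong zero    M≈M' = refl
  det-cong (suc n) {M} {M'} M≈M' = sumFin-cong (suc n) {expansion M} {expansion M'} (λ j →
    *-cong refl (*-cong (M≈M' zero j) (det-cong n (λ r s → M≈M' (suc r) (punchIn j s)))))
    where
    expansion : Matrix (suc n) (suc n) → Fin (suc n) → Carrier
    expansion N j = sign j * (N zero j * det n (λ r s → N (suc r) (punchIn j s)))

  -- The double alternating sum Σ_j Σ_l ± h(j, j') over ordered pairs j ≠ j',
  -- where j' = punchIn j l is the l-th index different from j.  Expanding a
  -- determinant along its first two rows produces such a sum.
  pairTerm : ∀ n → Matrix (suc n) (suc n) → Fin (suc n) → Fin n → Carrier
  pairTerm n h j l = sign l * h j (punchIn j l)

  pairRow : ∀ n → Matrix (suc n) (suc n) → Fin (suc n) → Carrier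
  pairRow n h j = sign j * sumFin n (pairTerm n h j)

  pairSum : ∀ n → Matrix (suc n) (suc n) → Carrier
  pairSum n h = sumFin (suc n) (pairRow n h)

  -- The pairs (j, j') and (j', j) carry opposite signs, so a symmetric h cancels.
  pairSum-symmetric : ∀ n (h : Matrix (suc n) (suc n)) → (∀ a b → h a b ≈ h b a) → pairSum n h ≈ 0#
  pairSum-symmetric zero    h h-sym = trans (+-identityʳ _) (zeroʳ _)
  pairSum-symmetric (suc n) h h-sym = begin
    1# * P + sumFin (suc n) (λ j → (- 1# * sign j) * inner j)
      ≈⟨ +-cong (*-identityˡ P) (sumFin-cong (suc n) {λ j → (- 1# * sign j) * inner j} {λ j → column j + pairRow n h' j} split) ⟩
    P + sumFin (suc n) (λ j → column j + pairRow n h' j)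
      ≈⟨ +-cong refl (sumFin-+ (suc n) column (pairRow n h')) ⟩
    P + (sumFin (suc n) column + pairSum n h')
      ≈⟨ +-cong refl (+-cong column-sum (pairSum-symmetric n h' (λ a b → h-sym (suc a) (suc b)))) ⟩
    P + (- 1# * P + 0#) ≈⟨ trans (+-cong refl (+-identityʳ _)) (x-x≈0 P) ⟩
    0# ∎
    where
    -- the row j = 0, and the terms l = 0 of the other rows
    P = sumFin (suc n) (λ l → sign l * h zero (suc l))
    column : Fin (suc n) → Carrier
    column j = (- 1# * sign j) * h (suc j) zero
    -- the remaining terms form the pair sum of the smaller matrix h'
    h' : Matrix (suc n) (suc n)
    h' a b = h (suc a) (suc b)
    inner : Fin (suc n) → Carrier
    inner j = 1# * h (suc j) zero + sumFin n (λ l → (- 1# * sign l) * h' j (punchIn j l))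
    -- the two signs (-1)^(j+1) and (-1)^(l+1) multiply to (-1)^(j+l)
    signs : ∀ j l → (- 1# * sign j) * ((- 1# * sign l) * h' j (punchIn j l)) ≈ sign j * pairTerm n h' j l
    signs j l = trans (*-solve 4 (λ e a b d → ((e ⊕ a) ⊕ ((e ⊕ b) ⊕ d)) ⊜ ((e ⊕ e) ⊕ (a ⊕ (b ⊕ d)))) refl _ _ _ _)
                      (trans (*-cong -1²≈1 refl) (*-identityˡ _))
    split : ∀ j → (- 1# * sign j) * inner j ≈ column j + pairRow n h' j
    split j = trans (distribˡ _ _ _) (+-cong (*-cong refl (*-identityˡ _))
      (trans (sumFin-*ˡ n (- 1# * sign j) (λ l → (- 1# * sign l) * h' j (punchIn j l)))
      (trans (sumFin-cong n (signs j)) (sym (sumFin-*ˡ n (sign j) (pairTerm n h' j))))))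
    -- by symmetry, the l = 0 terms give −P
    column-sum : sumFin (suc n) column ≈ - 1# * P
    column-sum = trans (sumFin-cong (suc n) {column} {λ j → - 1# * (sign j * h zero (suc j))}
                                    (λ j → trans (*-assoc _ _ _) (*-cong refl (*-cong refl (h-sym (suc j) zero)))))
                       (sym (sumFin-*ˡ (suc n) (- 1#) (λ l → sign l * h zero (suc l))))

  pairSum-+ : ∀ n h h' → pairSum n (λ a b → h a b + h' a b) ≈ pairSum n h + pairSum n h'
  pairSum-+ n h h' = trans (sumFin-cong (suc n) {pairRow n (λ a b → h a b + h' a b)} {λ j → pairRow n h j + pairRow n h' j} (λ j →
      trans (*-cong refl (trans (sumFin-cong n {pairTerm n (λ a b → h a b + h' a b) j}
                                                {λ l → pairTerm n h j l + pairTerm n h' j l} (λ l → distribˡ _ _ _))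
                                  (sumFin-+ n (pairTerm n h j) (pairTerm n h' j))))
            (distribˡ _ _ _)))
    (sumFin-+ (suc n) (pairRow n h) (pairRow n h'))

  pairSum-cong : ∀ n h h' → (∀ a b → h a b ≈ h' a b) → pairSum n h ≈ pairSum n h'
  pairSum-cong n h h' h≈h' = sumFin-cong (suc n) {pairRow n h} {pairRow n h'}
    (λ j → *-cong refl (sumFin-cong n {pairTerm n h j} {pairTerm n h' j} (λ l → *-cong refl (h≈h' j (punchIn j l)))))

  pairSum-transpose : ∀ n h → pairSum n (λ a b → h b a) ≈ - pairSum n h
  pairSum-transpose n h = inverseʳ-unique _ _ (trans (sym (pairSum-+ n h (λ a b → h b a)))
    (pairSum-symmetric n (λ a b → h a b + h b a) (λ a b → +-comm _ _)))

  -- avoid₂ a b s: the s-th column index different from a and b (a ≠ b),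
  -- defined so as to be symmetric in a and b.
  avoid₂ : ∀ {m} → Fin (suc (suc m)) → Fin (suc (suc m)) → Fin m → Fin (suc (suc m))
  avoid₂ zero    zero    s = suc (suc s)
  avoid₂ zero    (suc b) s = suc (punchIn b s)
  avoid₂ (suc a) zero    s = suc (punchIn a s)
  avoid₂ {suc m} (suc a) (suc b) zero    = zero
  avoid₂ {suc m} (suc a) (suc b) (suc s) = suc (avoid₂ a b s)

  avoid₂-sym : ∀ {m} a b (s : Fin m) → avoid₂ a b s ≡ avoid₂ b a s
  avoid₂-sym zero    zero    s = ≡.refl
  avoid₂-sym zero    (suc b) s = ≡.refl
  avoid₂-sym (suc a) zero    s = ≡.refl
  avoid₂-sym {suc m} (suc a) (suc b) zero    = ≡.refl
  avoid₂-sym {suc m} (suc a) (suc b) (suc s) = ≡.cong suc (avoid₂-sym a b s)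

  punchIn-punchIn : ∀ {m} (j : Fin (suc (suc m))) (l : Fin (suc m)) (s : Fin m) →
                    punchIn j (punchIn l s) ≡ avoid₂ j (punchIn j l) s
  punchIn-punchIn zero    l       s = ≡.refl
  punchIn-punchIn (suc j) zero    s = ≡.refl
  punchIn-punchIn {suc m} (suc j) (suc l) zero    = ≡.refl
  punchIn-punchIn {suc m} (suc j) (suc l) (suc s) = ≡.cong suc (punchIn-punchIn j l s)

  minor₂ : ∀ {m} → Matrix (suc (suc m)) (suc (suc m)) → Fin (suc (suc m)) → Fin (suc (suc m)) → Carrier
  minor₂ {m} M a b = det m (λ r s → M (suc (suc r)) (avoid₂ a b s))

  minor₂-sym : ∀ {m} M a b → minor₂ {m} M a b ≈ minor₂ M b a
  minor₂-sym {m} M a b = det-cong m (λ r s → reflexive (≡.cong (M (suc (suc r))) (avoid₂-sym a b s)))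

  twoRowTerm : ∀ {m} → Matrix (suc (suc m)) (suc (suc m)) → Matrix (suc (suc m)) (suc (suc m))
  twoRowTerm M a b = M zero a * (M (suc zero) b * minor₂ M a b)

  det-twoRows : ∀ m M → det (suc (suc m)) M ≈ pairSum (suc m) (twoRowTerm M)
  det-twoRows m M = sumFin-cong (suc (suc m))
    {λ j → sign j * (M zero j * det (suc m) (λ r s → M (suc r) (punchIn j s)))}
    {λ j → sign j * sumFin (suc m) (λ l → sign l * twoRowTerm M j (punchIn j l))}
    (λ j → *-cong refl (trans (sumFin-*ˡ (suc m) (M zero j) (λ l → sign l * (M (suc zero) (punchIn j l) * minor j l)))
                              (sumFin-cong (suc m) (term j))))
    where
    minor : Fin (suc (suc m)) → Fin (suc m) → Carrier
    minor j l = det m (λ r s → M (suc (suc r)) (punchIn j (punchIn l s)))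
    term : ∀ j l → M zero j * (sign l * (M (suc zero) (punchIn j l) * minor j l)) ≈ sign l * twoRowTerm M j (punchIn j l)
    term j l = trans (*-solve 4 (λ x s y d → (x ⊕ (s ⊕ (y ⊕ d))) ⊜ (s ⊕ (x ⊕ (y ⊕ d)))) refl _ _ _ _)
      (*-cong refl (*-cong refl (*-cong refl (det-cong m (λ r s → reflexive (≡.cong (M (suc (suc r))) (punchIn-punchIn j l s)))))))

  det-equal-rows01 : ∀ m M → (∀ s → M zero s ≈ M (suc zero) s) → det (suc (suc m)) M ≈ 0#
  det-equal-rows01 m M row0≈row1 = trans (det-twoRows m M) (pairSum-symmetric (suc m) (twoRowTerm M) symmetric)
    where
    symmetric : ∀ a b → twoRowTerm M a b ≈ twoRowTerm M b a
    symmetric a b = begin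
      M zero a * (M (suc zero) b * minor₂ M a b) ≈⟨ *-cong refl (*-cong (sym (row0≈row1 b)) refl) ⟩
      M zero a * (M zero b * minor₂ M a b)       ≈⟨ *-solve 3 (λ x y d → (x ⊕ (y ⊕ d)) ⊜ (y ⊕ (x ⊕ d))) refl _ _ _ ⟩
      M zero b * (M zero a * minor₂ M a b)       ≈⟨ *-cong refl (*-cong (row0≈row1 a) (minor₂-sym M a b)) ⟩
      M zero b * (M (suc zero) a * minor₂ M b a) ∎

  swap01 : ∀ {m n} → Matrix (suc (suc m)) n → Matrix (suc (suc m)) n
  swap01 M zero          = M (suc zero)
  swap01 M (suc zero)    = M zero
  swap01 M (suc (suc r)) = M (suc (suc r))

  det-swap01 : ∀ m M → det (suc (suc m)) (swap01 M) ≈ - det (suc (suc m)) M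
  det-swap01 m M = begin
    det (suc (suc m)) (swap01 M)                 ≈⟨ det-twoRows m (swap01 M) ⟩
    pairSum (suc m) (twoRowTerm (swap01 M))      ≈⟨ pairSum-cong (suc m) (twoRowTerm (swap01 M)) (λ a b → twoRowTerm M b a) (λ a b → trans (*-solve 3 (λ x y d → (x ⊕ (y ⊕ d)) ⊜ (y ⊕ (x ⊕ d))) refl _ _ _)
                                                                                (*-cong refl (*-cong refl (minor₂-sym M a b)))) ⟩
    pairSum (suc m) (λ a b → twoRowTerm M b a)  ≈⟨ pairSum-transpose (suc m) (twoRowTerm M) ⟩
    - pairSum (suc m) (twoRowTerm M)             ≈⟨ -‿cong (det-twoRows m M) ⟨
    - det (suc (suc m)) M                        ∎

  det-via-swap01 : ∀ m M → det (suc (suc m)) M ≈ - det (suc (suc m)) (swap01 M)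
  det-via-swap01 m M = trans (det-cong (suc (suc m)) swap-swap) (det-swap01 m (swap01 M))
    where
    swap-swap : ∀ r s → M r s ≈ swap01 (swap01 M) r s
    swap-swap zero          s = refl
    swap-swap (suc zero)    s = refl
    swap-swap (suc (suc r)) s = refl

  consRow : ∀ {m n} → (Fin n → Carrier) → Matrix m n → Matrix (suc m) n
  consRow v T zero    = v
  consRow v T (suc i) = T i

  snocRow : ∀ {m} {a} {X : Set a} → (Fin m → X) → X → Fin (suc m) → X
  snocRow {zero}  T v zero    = v
  snocRow {suc m} T v zero    = T zero
  snocRow {suc m} T v (suc i) = snocRow (λ i → T (suc i)) v i

  snocRow-map : ∀ {m} {a b} {X : Set a} {Y : Set b} (f : X → Y) (T : Fin m → X) v r →
                snocRow (λ i → f (T i)) (f v) r ≡ f (snocRow T v r)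
  snocRow-map {zero}  f T v zero    = ≡.refl
  snocRow-map {suc m} f T v zero    = ≡.refl
  snocRow-map {suc m} f T v (suc r) = snocRow-map f (λ i → T (suc i)) v r

  det-rotate : ∀ m (v : Fin (suc m) → Carrier) (T : Matrix m (suc m)) →
               det (suc m) (consRow v T) ≈ pow (- 1#) m * det (suc m) (snocRow T v)
  det-rotate zero    v T = trans (det-cong 1 {consRow v T} {snocRow T v} (λ { zero s → refl })) (sym (*-identityˡ _))
  det-rotate (suc m) v T = begin
    det (suc (suc m)) (consRow v T)                    ≈⟨ det-via-swap01 m (consRow v T) ⟩
    - det (suc (suc m)) (swap01 (consRow v T))         ≈⟨ -‿cong (sumFin-cong (suc (suc m)) {swappedTerm} {λ j → pow (- 1#) m * rotatedTerm j} expand) ⟩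
    - sumFin (suc (suc m)) (λ j → pow (- 1#) m * rotatedTerm j)
                                                       ≈⟨ -‿cong (sumFin-*ˡ (suc (suc m)) (pow (- 1#) m) rotatedTerm) ⟨
    - (pow (- 1#) m * det (suc (suc m)) (snocRow T v)) ≈⟨ -1*x≈-x _ ⟨
    - 1# * (pow (- 1#) m * det (suc (suc m)) (snocRow T v)) ≈⟨ *-assoc _ _ _ ⟨
    pow (- 1#) (suc m) * det (suc (suc m)) (snocRow T v) ∎
    where
    swappedTerm rotatedTerm : Fin (suc (suc m)) → Carrier
    swappedTerm j = sign j * (T zero j * det (suc m) (λ r s → swap01 (consRow v T) (suc r) (punchIn j s)))
    rotatedTerm j = sign j * (T zero j * det (suc m) (λ r s → snocRow T v (suc r) (punchIn j s)))
    -- after the swap, the minors again have v as first row: rotate them by induction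
    expand : ∀ j → swappedTerm j ≈ pow (- 1#) m * rotatedTerm j
    expand j = begin
      sign j * (T zero j * det (suc m) (λ r s → swap01 (consRow v T) (suc r) (punchIn j s)))
        ≈⟨ *-cong refl (*-cong refl (det-cong (suc m) minor≈)) ⟩
      sign j * (T zero j * det (suc m) (consRow (λ s → v (punchIn j s)) (λ i s → T (suc i) (punchIn j s))))
        ≈⟨ *-cong refl (*-cong refl (det-rotate m (λ s → v (punchIn j s)) (λ i s → T (suc i) (punchIn j s)))) ⟩
      sign j * (T zero j * (pow (- 1#) m * det (suc m) (snocRow (λ i s → T (suc i) (punchIn j s)) (λ s → v (punchIn j s)))))
        ≈⟨ *-cong refl (*-cong refl (*-cong refl (det-cong (suc m) (λ r s → reflexive
             (≡.cong (λ f → f s) (snocRow-map (λ row s → row (punchIn j s)) (λ i → T (suc i)) v r)))))) ⟩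
      sign j * (T zero j * (pow (- 1#) m * det (suc m) (λ r s → snocRow (λ i → T (suc i)) v r (punchIn j s))))
        ≈⟨ *-solve 4 (λ a b c d → (a ⊕ (b ⊕ (c ⊕ d))) ⊜ (c ⊕ (a ⊕ (b ⊕ d)))) refl _ _ _ _ ⟩
      pow (- 1#) m * rotatedTerm j ∎
      where
      minor≈ : ∀ r s → swap01 (consRow v T) (suc r) (punchIn j s) ≈ consRow (λ s → v (punchIn j s)) (λ i s → T (suc i) (punchIn j s)) r s
      minor≈ zero    s = refl
      minor≈ (suc r) s = refl

  det-repeated-row : ∀ m (T : Matrix m (suc m)) (i : Fin m) → det (suc m) (consRow (T i) T) ≈ 0#
  det-repeated-row (suc m) T zero    = det-equal-rows01 m (consRow (T zero) T) (λ s → refl)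
  det-repeated-row (suc m) T (suc i) = begin
    det (suc (suc m)) (consRow (T (suc i)) T)          ≈⟨ det-via-swap01 m (consRow (T (suc i)) T) ⟩
    - det (suc (suc m)) (swap01 (consRow (T (suc i)) T)) ≈⟨ -‿cong (sumFin-zero (suc (suc m)) {swappedTerm} minorVanishes) ⟩
    - 0#                                               ≈⟨ ε⁻¹≈ε ⟩
    0#                                                 ∎
    where
    swappedTerm : Fin (suc (suc m)) → Carrier
    swappedTerm j = sign j * (T zero j * det (suc m) (λ r s → swap01 (consRow (T (suc i)) T) (suc r) (punchIn j s)))
    -- after the swap, every minor has first row equal to its i-th row
    minorVanishes : ∀ j → swappedTerm j ≈ 0#
    minorVanishes j = trans (*-cong refl (trans (*-cong refl (trans (det-cong (suc m) minor≈)
                              (det-repeated-row m (λ i' s → T (suc i') (punchIn j s)) i))) (zeroʳ _))) (zeroʳ _)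
      where
      minor≈ : ∀ r s → swap01 (consRow (T (suc i)) T) (suc r) (punchIn j s)
                     ≈ consRow (λ s → T (suc i) (punchIn j s)) (λ i' s → T (suc i') (punchIn j s)) r s
      minor≈ zero    s = refl
      minor≈ (suc r) s = refl

  det-linear : ∀ m K (coeff : ℕ → Carrier) (V : ℕ → Fin (suc m) → Carrier) (T : Matrix m (suc m)) →
               det (suc m) (consRow (λ s → sumN K (λ a → coeff a * V a s)) T)
               ≈ sumN K (λ a → coeff a * det (suc m) (consRow (V a) T))
  det-linear m K coeff V T = begin
    sumFin (suc m) (λ j → sign j * (sumN K (λ a → coeff a * V a j) * minor j))
      ≈⟨ sumFin-cong (suc m) {λ j → sign j * (sumN K (λ a → coeff a * V a j) * minor j)} {λ j → sumN K (term j)} distribute ⟩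
    sumFin (suc m) (λ j → sumN K (term j))
      ≈⟨ sumFin-sumN (suc m) K term ⟩
    sumN K (λ a → sumFin (suc m) (λ j → term j a))
      ≈⟨ sumN-cong K (λ a → sumFin-*ˡ (suc m) (coeff a) (λ j → sign j * (V a j * minor j))) ⟨
    sumN K (λ a → coeff a * det (suc m) (consRow (V a) T)) ∎
    where
    minor : Fin (suc m) → Carrier
    minor j = det m (λ r s → T r (punchIn j s))
    term : Fin (suc m) → ℕ → Carrier
    term j a = coeff a * (sign j * (V a j * minor j))
    distribute : ∀ j → sign j * (sumN K (λ a → coeff a * V a j) * minor j) ≈ sumN K (term j)
    distribute j = trans (*-cong refl (sumN-*ʳ K (minor j) (λ a → coeff a * V a j)))
      (trans (sumN-*ˡ K (sign j) (λ a → coeff a * V a j * minor j))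
             (sumN-cong K (λ a → *-solve 4 (λ s c v x → (s ⊕ ((c ⊕ v) ⊕ x)) ⊜ (c ⊕ (s ⊕ (v ⊕ x)))) refl (sign j) (coeff a) (V a j) (minor j))))

  det-zero-column : ∀ n M → (∀ r → M r zero ≈ 0#) → det (suc n) M ≈ 0#
  det-zero-column n M col≈0 = trans (+-cong firstTerm (otherTerms n M col≈0)) (+-identityʳ 0#)
    where
    firstTerm : sign {suc n} zero * (M zero zero * det n (λ r s → M (suc r) (suc s))) ≈ 0#
    firstTerm = trans (*-cong refl (trans (*-cong (col≈0 zero) refl) (zeroˡ _))) (zeroʳ _)
    -- the minors of the other entries keep the zero column
    otherTerms : ∀ n (M : Matrix (suc n) (suc n)) → (∀ r → M r zero ≈ 0#) →
                 sumFin n (λ j → sign (suc j) * (M zero (suc j) * det n (λ r s → M (suc r) (punchIn (suc j) s)))) ≈ 0#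
    otherTerms zero    M col≈0 = refl
    otherTerms (suc n) M col≈0 = sumFin-zero (suc n)
      {λ j → sign (suc j) * (M zero (suc j) * det (suc n) (λ r s → M (suc r) (punchIn (suc j) s)))}
      (λ j → trans (*-cong refl (trans (*-cong refl (det-zero-column n (λ r s → M (suc r) (punchIn (suc j) s))
                                                                      (λ r → col≈0 (suc r)))) (zeroʳ _))) (zeroʳ _))

  det-unitriangular : ∀ n M → (∀ r s → toℕ s < toℕ r → M r s ≈ 0#) → (∀ r → M r r ≈ 1#) → det n M ≈ 1#
  det-unitriangular zero    M lower≈0 diag≈1 = refl
  det-unitriangular (suc n) M lower≈0 diag≈1 = trans (+-cong firstTerm (otherTerms n M lower≈0)) (+-identityʳ 1#)
    where
    firstTerm : sign {suc n} zero * (M zero zero * det n (λ r s → M (suc r) (suc s))) ≈ 1#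
    firstTerm = trans (*-identityˡ _) (trans (*-cong (diag≈1 zero)
      (det-unitriangular n (λ r s → M (suc r) (suc s)) (λ r s s<r → lower≈0 (suc r) (suc s) (s≤s s<r)) (λ r → diag≈1 (suc r))))
      (*-identityˡ 1#))
    -- the minors of the other first-row entries have a zero first column
    otherTerms : ∀ n (M : Matrix (suc n) (suc n)) → (∀ r s → toℕ s < toℕ r → M r s ≈ 0#) →
                 sumFin n (λ j → sign (suc j) * (M zero (suc j) * det n (λ r s → M (suc r) (punchIn (suc j) s)))) ≈ 0#
    otherTerms zero    M lower≈0 = refl
    otherTerms (suc n) M lower≈0 = sumFin-zero (suc n)
      {λ j → sign (suc j) * (M zero (suc j) * det (suc n) (λ r s → M (suc r) (punchIn (suc j) s)))}
      (λ j → trans (*-cong refl (trans (*-cong refl (det-zero-column n (λ r s → M (suc r) (punchIn (suc j) s))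
                                                                      (λ r → lower≈0 (suc r) zero (s≤s z≤n)))) (zeroʳ _))) (zeroʳ _))

module GeneratingFunction {c ℓ} (R : CommutativeRing c ℓ) (q : CommutativeRing.Carrier R) where
  open CommutativeRing R hiding (zero)
  open WithRing R
  open RingFacts R
  open Compositions
  open Determinants R
  open import Data.Fin using (Fin; zero; suc; toℕ; fromℕ<)
  import Data.Fin.Properties as FinP
  open import Data.Nat.Combinatorics using (_C_; nCk+nC[k+1]≡[n+1]C[k+1]; nC1≡n)
  open import Data.Nat using (zero; _<_; _≤ᵇ_; _<ᵇ_; _≤?_; _%_; _≡ᵇ_)
  import Data.Nat.Properties as ℕP
  open import Data.Bool using (Bool; true; false; if_then_else_; _∧_)
  open import Data.List using (List; []; _∷_; _++_; [_]; map; length)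
  open import Data.List.Relation.Unary.All as All using (All; []; _∷_; all?)
  import Data.Integer as ℤ
  import Data.Integer.Properties as ℤP
  open import Relation.Nullary using (does; yes; no)
  import Relation.Binary.PropositionalEquality as ≡
  open ≡ using (_≢_)
  open import Relation.Binary.Reasoning.Setoid setoid
  open import Algebra.Solver.CommutativeMonoid *-commutativeMonoid using (_⊕_; _⊜_) renaming (solve to *-solve)
  open import Algebra.Properties.CommutativeSemigroup +-commutativeSemigroup using (interchange)

  -- Blocks of size larger than K get weight zero.
  cap : ℕ → (ℕ → Carrier) → ℕ → Carrier
  cap K z i = if i ≤ᵇ K then z i else 0#

  weight : (ℕ → Carrier) → List ℕ → Carrier
  weight w c = prodL (map (λ p → w (suc p)) c) * pow q (rbComp 0 c)

  compSum : ℕ → (ℕ → Carrier) → Carrier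
  compSum n w = sumOver (compositions n) (weight w)

  capped-product : ∀ K (z : ℕ → Carrier) o c →
    (if does (all? (λ B → length B ≤? K) (blocksFrom o c)) then prodL (map (λ B → z (length B)) (blocksFrom o c)) else 0#)
    ≈ prodL (map (λ p → cap K z (suc p)) c)
  capped-product K z o []      = refl
  capped-product K z o (p ∷ c) = trans
    (guarded-* (length (interval o p) ≤ᵇ K) _ (z (length (interval o p))) _ _ (capped-product K z (o +ℕ suc p) c))
    (*-cong (reflexive (≡.cong (λ L → if L ≤ᵇ K then z L else 0#) (length-interval o p))) refl)
    where
    guarded-* : ∀ (b₁ b₂ : Bool) x y Y → (if b₂ then y else 0#) ≈ Y →
                (if b₁ ∧ b₂ then x * y else 0#) ≈ (if b₁ then x else 0#) * Y
    guarded-* true  true  x y Y e = *-cong refl e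
    guarded-* true  false x y Y e = trans (sym (zeroʳ x)) (*-cong refl e)
    guarded-* false b₂    x y Y e = sym (zeroˡ Y)

  G≈compSum : ∀ K n z → G K n z q ≈ compSum n (cap K z)
  G≈compSum K n z = begin
    G K n z q                                                ≈⟨ sumOver-filter P? (layered n) partitionWeight ⟩
    sumOver (layered n) guardedWeight                        ≡⟨ ≡.cong (λ L → sumOver L guardedWeight) (layered≡compositions n) ⟩
    sumOver (map (blocksFrom 0) (compositions n)) guardedWeight ≡⟨ sumOver-map (blocksFrom 0) (compositions n) guardedWeight ⟩
    sumOver (compositions n) (λ c → guardedWeight (blocksFrom 0 c)) ≈⟨ sumOver-cong (compositions n) agree ⟩
    compSum n (cap K z)                                      ∎
    where
    P? = all? (λ B → length B ≤? K)
    partitionWeight : Partition → Carrier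
    partitionWeight π = prodL (map (λ B → z (length B)) π) * pow q (rb π)
    guardedWeight : Partition → Carrier
    guardedWeight π = if does (P? π) then partitionWeight π else 0#
    agree : ∀ c → guardedWeight (blocksFrom 0 c) ≈ weight (cap K z) c
    agree c = trans (sym (if-* (does (P? (blocksFrom 0 c))) _ _))
      (*-cong (capped-product K z 0 c) (reflexive (≡.cong (pow q) (rb-blocksFrom [] 0 c []))))

  prodL-snoc : ∀ (f : ℕ → Carrier) c a → prodL (map f (c ++ [ a ])) ≈ prodL (map f c) * f a
  prodL-snoc f []      a = *-comm (f a) 1#
  prodL-snoc f (p ∷ c) a = trans (*-cong refl (prodL-snoc f c a)) (sym (*-assoc _ _ _))

  prodL-cong : ∀ {f g : ℕ → Carrier} c → (∀ i → f i ≈ g i) → prodL (map f c) ≈ prodL (map g c)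
  prodL-cong []      f≈g = refl
  prodL-cong (p ∷ c) f≈g = *-cong (f≈g p) (prodL-cong c f≈g)

  prodL-scale : ∀ (w : ℕ → Carrier) t c →
                prodL (map (λ p → scale w t (suc p)) c) ≈ prodL (map (λ p → w (suc p)) c) * pow t (length c)
  prodL-scale w t []      = sym (*-identityˡ 1#)
  prodL-scale w t (p ∷ c) = trans (*-cong refl (prodL-scale w t c))
    (*-solve 4 (λ a t P T → ((a ⊕ t) ⊕ (P ⊕ T)) ⊜ ((a ⊕ P) ⊕ (t ⊕ T))) refl (w (suc p)) t _ _)

  weight-snoc : ∀ w c a → weight w (c ++ [ a ]) ≈ weight w c * (w (suc a) * pow q (size c))
  weight-snoc w c a = begin
    weight w (c ++ [ a ])                           ≈⟨ *-cong (prodL-snoc (λ p → w (suc p)) c a) (reflexive (≡.cong (pow q) (rbComp-snoc 0 c a))) ⟩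
    (P * w (suc a)) * pow q (rbComp 0 c +ℕ size c)  ≈⟨ *-cong refl (pow-+ q (rbComp 0 c) (size c)) ⟩
    (P * w (suc a)) * (pow q (rbComp 0 c) * pow q (size c))
      ≈⟨ *-solve 4 (λ P a r s → ((P ⊕ a) ⊕ (r ⊕ s)) ⊜ ((P ⊕ r) ⊕ (a ⊕ s))) refl P (w (suc a)) _ _ ⟩
    weight w c * (w (suc a) * pow q (size c))       ∎
    where P = prodL (map (λ p → w (suc p)) c)

  weight-cons : ∀ w a c → weight w (a ∷ c) ≈ w (suc a) * weight (scale w (pow q (suc a))) c
  weight-cons w a c = begin
    (w (suc a) * P) * pow q (rbComp (suc a) c)                ≡⟨ ≡.cong (λ e → (w (suc a) * P) * pow q e) (rbComp-shift (suc a) c) ⟩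
    (w (suc a) * P) * pow q (rbComp 0 c +ℕ suc a *ℕ length c) ≈⟨ *-cong refl (trans (pow-+ q (rbComp 0 c) _) (*-cong refl (pow-* q (suc a) (length c)))) ⟩
    (w (suc a) * P) * (pow q (rbComp 0 c) * pow t (length c))
      ≈⟨ *-solve 4 (λ a P r T → ((a ⊕ P) ⊕ (r ⊕ T)) ⊜ (a ⊕ ((P ⊕ T) ⊕ r))) refl (w (suc a)) P _ _ ⟩
    w (suc a) * ((P * pow t (length c)) * pow q (rbComp 0 c)) ≈⟨ *-cong refl (*-cong (prodL-scale w t c) refl) ⟨
    w (suc a) * weight (scale w t) c                          ∎
    where
    P = prodL (map (λ p → w (suc p)) c)
    t = pow q (suc a)

  compSum-cong : ∀ n {w w'} → (∀ i → w i ≈ w' i) → compSum n w ≈ compSum n w'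
  compSum-cong n w≈w' = sumOver-cong (compositions n) (λ c → *-cong (prodL-cong c (λ p → w≈w' (suc p))) refl)

  sumOver-compositions≡ : ∀ {m m'} → m ≡ m' → (f : List ℕ → Carrier) →
                          sumOver (compositions m) f ≈ sumOver (compositions m') f
  sumOver-compositions≡ ≡.refl f = refl

  sumOver-byLastPart : ∀ n (f : List ℕ → Carrier) →
    sumOver (compositions (suc n)) f ≈ sumN (suc n) (λ a → sumOver (compositions (n ∸ a)) (λ c → f (c ++ [ a ])))
  sumOver-byLastPart zero    f = sym (+-identityʳ _)
  sumOver-byLastPart (suc n) f = begin
    sumOver (compositions (suc (suc n))) f
      ≈⟨ sumOver-concatMap extend (compositions (suc n)) f ⟩
    sumOver (compositions (suc n)) (λ c → f (c ++ [ 0 ]) + sumOver (growLast c) f)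
      ≈⟨ sumOver-+ (compositions (suc n)) _ _ ⟩
    sumOver (compositions (suc n)) (λ c → f (c ++ [ 0 ])) + sumOver (compositions (suc n)) (λ c → sumOver (growLast c) f)
      ≈⟨ +-cong refl (sumOver-byLastPart n _) ⟩
    sumOver (compositions (suc n)) (λ c → f (c ++ [ 0 ]))
      + sumN (suc n) (λ a → sumOver (compositions (n ∸ a)) (λ c → sumOver (growLast (c ++ [ a ])) f))
      ≈⟨ +-cong refl (sumN-cong (suc n) (λ a → sumOver-cong (compositions (n ∸ a)) (λ c →
           trans (reflexive (≡.cong (λ L → sumOver L f) (growLast-snoc c a))) (+-identityʳ _)))) ⟩
    sumOver (compositions (suc n)) (λ c → f (c ++ [ 0 ]))
      + sumN (suc n) (λ a → sumOver (compositions (n ∸ a)) (λ c → f (c ++ [ suc a ]))) ∎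

  sumOver-byFirstPart : ∀ n (f : List ℕ → Carrier) →
    sumOver (compositions (suc n)) f ≈ sumN (suc n) (λ a → sumOver (compositions (n ∸ a)) (λ c → f (a ∷ c)))
  sumOver-byFirstPart zero    f = sym (+-identityʳ _)
  sumOver-byFirstPart (suc n) f = begin
    sumOver (compositions (suc (suc n))) f ≈⟨ sumOver-concatMap extend (compositions (suc n)) f ⟩
    sumOver (compositions (suc n)) g       ≈⟨ sumOver-byFirstPart n g ⟩
    sumN (suc n) X                         ≈⟨ sumN-last n X ⟩
    sumN n X + X n                         ≈⟨ +-cong (sumN-cong< n X≈Y) Xn≈ ⟩
    sumN n Y + (Y n + Y (suc n))           ≈⟨ +-assoc _ _ _ ⟨
    (sumN n Y + Y n) + Y (suc n)           ≈⟨ +-cong (sumN-last n Y) refl ⟨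
    sumN (suc n) Y + Y (suc n)             ≈⟨ sumN-last (suc n) Y ⟨
    sumN (suc (suc n)) Y                   ∎
    where
    g : List ℕ → Carrier
    g c = sumOver (extend c) f
    -- X a: extensions of compositions of n+1 with first part a+1;
    -- Y a: compositions of n+2 with first part a+1.
    X Y : ℕ → Carrier
    X a = sumOver (compositions (n ∸ a)) (λ c → g (a ∷ c))
    Y a = sumOver (compositions (suc n ∸ a)) (λ c → f (a ∷ c))
    -- the composition (n+1) extends to (n+1, 1) and to (n+2)
    Xn≈ : X n ≈ Y n + Y (suc n)
    Xn≈ = begin
      X n                                               ≈⟨ sumOver-compositions≡ (ℕP.n∸n≡0 n) _ ⟩
      (f (n ∷ 0 ∷ []) + (f (suc n ∷ []) + 0#)) + 0#    ≈⟨ trans (+-identityʳ _) (+-cong (sym (+-identityʳ _)) refl) ⟩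
      (f (n ∷ 0 ∷ []) + 0#) + (f (suc n ∷ []) + 0#)    ≈⟨ +-cong (sumOver-compositions≡ (ℕP.m+n∸n≡m 1 n) _) refl ⟨
      Y n + (f (suc n ∷ []) + 0#)                       ≈⟨ +-cong refl (sumOver-compositions≡ (ℕP.n∸n≡0 n) _) ⟨
      Y n + Y (suc n)                                   ∎
    -- for a < n the rest of the composition is nonempty, and extending it
    -- commutes with prepending the first part
    X≈Y : ∀ a → a < n → X a ≈ Y a
    X≈Y a a<n = begin
      X a ≈⟨ sumOver-congᴬ (≡.subst (λ m → All (_≢ []) (compositions m)) (≡.sym n∸a≡1+m) (compositions-nonempty m)) prepend ⟩
      sumOver (compositions (n ∸ a)) (λ c → sumOver (extend c) (λ d → f (a ∷ d)))
          ≈⟨ sumOver-concatMap extend (compositions (n ∸ a)) _ ⟨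
      sumOver (compositions (suc (n ∸ a))) (λ c → f (a ∷ c))
          ≈⟨ sumOver-compositions≡ (≡.sym (ℕP.+-∸-assoc 1 (ℕP.<⇒≤ a<n))) _ ⟩
      Y a ∎
      where
      m = n ∸ suc a
      n∸a≡1+m : n ∸ a ≡ suc m
      n∸a≡1+m = ℕP.+-∸-assoc 1 a<n
      prepend : ∀ c → c ≢ [] → g (a ∷ c) ≈ sumOver (extend c) (λ d → f (a ∷ d))
      prepend c c≢[] = +-cong refl (trans (reflexive (≡.cong (λ L → sumOver L f) (growLast-cons a c c≢[])))
                                          (reflexive (sumOver-map (a ∷_) (growLast c) f)))

  compSum-byLastBlock : ∀ n w → compSum (suc n) w ≈ sumN (suc n) (λ a → compSum (n ∸ a) w * (w (suc a) * pow q (n ∸ a)))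
  compSum-byLastBlock n w = trans (sumOver-byLastPart n (weight w)) (sumN-cong (suc n) (λ a →
    trans (sumOver-congᴬ (compositions-size (n ∸ a))
            (λ c size≡ → trans (weight-snoc w c a) (*-cong refl (*-cong refl (reflexive (≡.cong (pow q) size≡))))))
          (sym (sumOver-*ʳ (compositions (n ∸ a)) _ (weight w)))))

  compSum-byFirstBlock : ∀ n w → compSum (suc n) w ≈ sumN (suc n) (λ a → w (suc a) * compSum (n ∸ a) (scale w (pow q (suc a))))
  compSum-byFirstBlock n w = trans (sumOver-byFirstPart n (weight w)) (sumN-cong (suc n) (λ a →
    trans (sumOver-cong (compositions (n ∸ a)) (λ c → weight-cons w a c)) (sym (sumOver-*ˡ (compositions (n ∸ a)) _ _))))

  G-zero : ∀ K z → G K 0 z q ≈ 1#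
  G-zero K z = trans (G≈compSum K 0 z) (trans (+-identityʳ _) (*-identityˡ 1#))

  G-cong : ∀ K n {z z'} → (∀ i → z i ≈ z' i) → G K n z q ≈ G K n z' q
  G-cong K n {z} {z'} z≈z' = begin
    G K n z q            ≈⟨ G≈compSum K n z ⟩
    compSum n (cap K z)  ≈⟨ compSum-cong n (λ i → if-cong (i ≤ᵇ K) (z≈z' i)) ⟩
    compSum n (cap K z') ≈⟨ G≈compSum K n z' ⟨
    G K n z' q           ∎

  compSum-cap-scale : ∀ K n z t → compSum n (scale (cap K z) t) ≈ G K n (scale z t) q
  compSum-cap-scale K n z t = trans (compSum-cong n (λ i → if-* (i ≤ᵇ K) (z i) t)) (sym (G≈compSum K n (scale z t)))

  scale-scale : ∀ (z : ℕ → Carrier) m a i → scale (scale z (pow q m)) (pow q a) i ≈ scale z (pow q (m +ℕ a)) i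
  scale-scale z m a i = trans (*-assoc _ _ _) (*-cong refl (sym (pow-+ q m a)))

  -- Gsub K n d w = G^K_{n−d}(w), read as 0 when d > n.
  Gsub : ℕ → ℕ → ℕ → (ℕ → Carrier) → Carrier
  Gsub K n       zero    w = G K n w q
  Gsub K zero    (suc d) w = 0#
  Gsub K (suc n) (suc d) w = Gsub K n d w

  Gsub-guarded : ∀ K n a w → Gsub K n a w ≈ (if a <ᵇ suc n then G K (n ∸ a) w q else 0#)
  Gsub-guarded K n       zero    w = refl
  Gsub-guarded K zero    (suc a) w = refl
  Gsub-guarded K (suc n) (suc a) w = Gsub-guarded K n a w

  Gsub-cong : ∀ K n a {w w'} → (∀ i → w i ≈ w' i) → Gsub K n a w ≈ Gsub K n a w'
  Gsub-cong K n       zero    w≈w' = G-cong K n w≈w'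
  Gsub-cong K zero    (suc a) w≈w' = refl
  Gsub-cong K (suc n) (suc a) w≈w' = Gsub-cong K n a w≈w'

  Gsub-diag : ∀ K n d w → Gsub K (n +ℕ d) d w ≡ G K n w q
  Gsub-diag K n zero    w = ≡.cong (λ x → G K x w q) (ℕP.+-identityʳ n)
  Gsub-diag K n (suc d) w = ≡.trans (≡.cong (λ x → Gsub K x (suc d) w) (ℕP.+-suc n d)) (Gsub-diag K n d w)

  Gsub-vanishes : ∀ K n d w → n < d → Gsub K n d w ≡ 0#
  Gsub-vanishes K zero    (suc d) w _         = ≡.refl
  Gsub-vanishes K (suc n) (suc d) w (s≤s n<d) = Gsub-vanishes K n d w n<d

  Gsub-≤ : ∀ K n d w → d ≤ n → Gsub K n d w ≡ G K (n ∸ d) w q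
  Gsub-≤ K n       zero    w _         = ≡.refl
  Gsub-≤ K (suc n) (suc d) w (s≤s d≤n) = Gsub-≤ K n d w d≤n

  Gℤ≡Gsub : ∀ K m d w → Gℤ K (ℤ.+ m ℤ.- ℤ.+ d) w q ≡ Gsub K m d w
  Gℤ≡Gsub K m zero    w = ≡.cong (λ x → G K x w q) (ℕP.+-identityʳ m)
  Gℤ≡Gsub K m (suc d) w = ⊖-case m (suc d)
    where
    ⊖-case : ∀ m d → Gℤ K (m ℤ.⊖ d) w q ≡ Gsub K m d w
    ⊖-case m       zero    = ≡.refl
    ⊖-case zero    (suc d) = ≡.refl
    ⊖-case (suc m) (suc d) = ≡.trans (≡.cong (λ i → Gℤ K i w q) (ℤP.[1+m]⊖[1+n]≡m⊖n m d)) (⊖-case m d)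

  G-byFirstBlock : ∀ K n z → G K (suc n) z q ≈ sumN K (λ a → z (suc a) * Gsub K n a (scale z (pow q (suc a))))
  G-byFirstBlock K n z = begin
    G K (suc n) z q               ≈⟨ G≈compSum K (suc n) z ⟩
    compSum (suc n) (cap K z)     ≈⟨ compSum-byFirstBlock n (cap K z) ⟩
    sumN (suc n) (λ a → cap K z (suc a) * compSum (n ∸ a) (scale (cap K z) (pow q (suc a))))
      ≈⟨ sumN-cong (suc n) (λ a → trans (if-* (a <ᵇ K) (z (suc a)) _)
                                          (if-cong (a <ᵇ K) (*-cong refl (compSum-cap-scale K (n ∸ a) z (pow q (suc a)))))) ⟩
    sumN (suc n) (λ a → if a <ᵇ K then term a else 0#) ≈⟨ sumN-guard-swap (suc n) K term ⟩
    sumN K (λ a → if a <ᵇ suc n then term a else 0#)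
      ≈⟨ sumN-cong K (λ a → trans (sym (*-if (a <ᵇ suc n) _ _)) (*-cong refl (sym (Gsub-guarded K n a _)))) ⟩
    sumN K (λ a → z (suc a) * Gsub K n a (scale z (pow q (suc a)))) ∎
    where
    term : ℕ → Carrier
    term a = z (suc a) * G K (n ∸ a) (scale z (pow q (suc a))) q

  G-byLastBlock : ∀ K n z → G K (suc n) z q ≈ sumN K (λ a → Gsub K n a z * (z (suc a) * pow q (n ∸ a)))
  G-byLastBlock K n z = begin
    G K (suc n) z q               ≈⟨ G≈compSum K (suc n) z ⟩
    compSum (suc n) (cap K z)     ≈⟨ compSum-byLastBlock n (cap K z) ⟩
    sumN (suc n) (λ a → compSum (n ∸ a) (cap K z) * (cap K z (suc a) * pow q (n ∸ a)))
      ≈⟨ sumN-cong (suc n) (λ a → trans (*-cong (sym (G≈compSum K (n ∸ a) z)) (if-* (a <ᵇ K) (z (suc a)) (pow q (n ∸ a))))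
                                         (*-if (a <ᵇ K) (G K (n ∸ a) z q) _)) ⟩
    sumN (suc n) (λ a → if a <ᵇ K then term a else 0#) ≈⟨ sumN-guard-swap (suc n) K term ⟩
    sumN K (λ a → if a <ᵇ suc n then term a else 0#)
      ≈⟨ sumN-cong K (λ a → trans (sym (if-* (a <ᵇ suc n) _ _)) (*-cong (sym (Gsub-guarded K n a _)) refl)) ⟩
    sumN K (λ a → Gsub K n a z * (z (suc a) * pow q (n ∸ a))) ∎
    where
    term : ℕ → Carrier
    term a = G K (n ∸ a) z q * (z (suc a) * pow q (n ∸ a))

  G-recurrence : ∀ K n z → 1 ≤ n →
    G K n z q ≈ sumN K (λ a → z (suc a) * Gℤ K (ℤ.+ n ℤ.- ℤ.+ suc a) (scale z (pow q (suc a))) q)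
  G-recurrence K (suc n) z _ = trans (G-byFirstBlock K n z) (sumN-cong K (λ a →
    *-cong refl (reflexive (≡.sym (Gℤ≡Gsub K (suc n) (suc a) (scale z (pow q (suc a))))))))

  -- The correction term z_{a+2} q^{m−b−1} G_{m−b−1}(z) G_{n−a−2+b+1}(z q^{m+a+2−b−1})
  -- of the convolution identity (i = a+2, j = b+1 in the paper).
  convTerm : ℕ → (ℕ → Carrier) → ℕ → ℕ → ℕ → ℕ → Carrier
  convTerm K z m n a b = z (suc (suc a)) * (pow q (m ∸ suc b)
    * (Gsub K m (suc b) z * Gsub K (n +ℕ suc b) (suc (suc a)) (scale z (pow q ((m +ℕ suc (suc a)) ∸ suc b)))))

  -- The common term z_1 q^m G_m(z) G_n(z q^{m+1}) of both expansions below: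
  -- a singleton block {m+1} between the first m and the last n elements.
  singletonSplit : ℕ → (ℕ → Carrier) → ℕ → ℕ → Carrier
  singletonSplit K z m n = G K m z q * ((z 1 * pow q m) * G K n (scale z (pow q (suc m))) q)

  convolution-expandRight : ∀ k' m n z →
    G (suc k') m z q * G (suc k') (suc n) (scale z (pow q m)) q
    ≈ singletonSplit (suc k') z m n + sumN k' (λ a → convTerm (suc k') z (suc m) n a 0)
  convolution-expandRight k' m n z = begin
    G k m z q * G k (suc n) w q
      ≈⟨ *-cong refl (G-byFirstBlock k n w) ⟩
    G k m z q * ((z 1 * pow q m) * Gsub k n 0 (scale w (pow q 1)) + sumN k' (λ a → (z (suc (suc a)) * pow q m) * longer a))
      ≈⟨ distribˡ _ _ _ ⟩
    G k m z q * ((z 1 * pow q m) * Gsub k n 0 (scale w (pow q 1))) + G k m z q * sumN k' (λ a → (z (suc (suc a)) * pow q m) * longer a)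
      ≈⟨ +-cong (*-cong refl (*-cong refl (G-cong k n (λ i → trans (scale-scale z m 1 i) (*-cong refl (reflexive (≡.cong (pow q) (ℕP.+-comm m 1))))))))
                (sumN-*ˡ k' _ _) ⟩
    singletonSplit k z m n + sumN k' (λ a → G k m z q * ((z (suc (suc a)) * pow q m) * longer a))
      ≈⟨ +-cong refl (sumN-cong k' term≈) ⟩
    singletonSplit k z m n + sumN k' (λ a → convTerm k z (suc m) n a 0) ∎
    where
    k = suc k'
    w = scale z (pow q m)
    longer : ℕ → Carrier
    longer a = Gsub k n (suc a) (scale w (pow q (suc (suc a))))
    term≈ : ∀ a → G k m z q * ((z (suc (suc a)) * pow q m) * longer a) ≈ convTerm k z (suc m) n a 0
    term≈ a = begin
      G k m z q * ((z (suc (suc a)) * pow q m) * longer a)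
        ≈⟨ *-cong refl (*-cong refl (trans (Gsub-cong k n (suc a) (λ i → scale-scale z m (suc (suc a)) i))
             (reflexive (≡.cong (λ x → Gsub k x (suc (suc a)) (scale z (pow q (m +ℕ suc (suc a))))) (ℕP.+-comm 1 n))))) ⟩
      G k m z q * ((z (suc (suc a)) * pow q m) * Gsub k (n +ℕ 1) (suc (suc a)) (scale z (pow q (m +ℕ suc (suc a)))))
        ≈⟨ *-solve 4 (λ g y Q h → (g ⊕ ((y ⊕ Q) ⊕ h)) ⊜ (y ⊕ (Q ⊕ (g ⊕ h)))) refl _ _ _ _ ⟩
      convTerm k z (suc m) n a 0 ∎

  convolution-expandLeft : ∀ k' m n z →
    G (suc k') (suc m) z q * G (suc k') n (scale z (pow q (suc m))) q
    ≈ singletonSplit (suc k') z m n + sumN k' (λ a → convTerm (suc k') z m (suc n) a a)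
  convolution-expandLeft k' m n z = begin
    G k (suc m) z q * Gn
      ≈⟨ *-cong (G-byLastBlock k m z) refl ⟩
    (G k m z q * (z 1 * pow q m) + sumN k' (λ a → Gsub k m (suc a) z * (z (suc (suc a)) * pow q (m ∸ suc a)))) * Gn
      ≈⟨ distribʳ _ _ _ ⟩
    (G k m z q * (z 1 * pow q m)) * Gn + sumN k' (λ a → Gsub k m (suc a) z * (z (suc (suc a)) * pow q (m ∸ suc a))) * Gn
      ≈⟨ +-cong (*-assoc _ _ _) (sumN-*ʳ k' _ _) ⟩
    singletonSplit k z m n + sumN k' (λ a → (Gsub k m (suc a) z * (z (suc (suc a)) * pow q (m ∸ suc a))) * Gn)
      ≈⟨ +-cong refl (sumN-cong k' term≈) ⟩
    singletonSplit k z m n + sumN k' (λ a → convTerm k z m (suc n) a a) ∎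
    where
    k = suc k'
    Gn = G k n (scale z (pow q (suc m))) q
    term≈ : ∀ a → (Gsub k m (suc a) z * (z (suc (suc a)) * pow q (m ∸ suc a))) * Gn ≈ convTerm k z m (suc n) a a
    term≈ a = begin
      (Gsub k m (suc a) z * (z (suc (suc a)) * pow q (m ∸ suc a))) * Gn
        ≈⟨ *-solve 4 (λ g y Q h → ((g ⊕ (y ⊕ Q)) ⊕ h) ⊜ (y ⊕ (Q ⊕ (g ⊕ h)))) refl _ _ _ _ ⟩
      z (suc (suc a)) * (pow q (m ∸ suc a) * (Gsub k m (suc a) z * Gn))
        ≡⟨ ≡.cong (λ x → z (suc (suc a)) * (pow q (m ∸ suc a) * (Gsub k m (suc a) z * x)))
                  (≡.sym (≡.trans (≡.cong (λ x → Gsub k (n +ℕ suc a) (suc a) (scale z (pow q x))) exponent)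
                                   (Gsub-diag k n (suc a) (scale z (pow q (suc m)))))) ⟩
      convTerm k z m (suc n) a a ∎
      where
      exponent : (m +ℕ suc (suc a)) ∸ suc a ≡ suc m
      exponent = ≡.trans (≡.cong (_∸ suc a) (ℕP.+-suc m (suc a))) (ℕP.m+n∸n≡m (suc m) (suc a))

  G-convolution : ∀ k' m n z → G (suc k') (m +ℕ n) z q
    ≈ G (suc k') m z q * G (suc k') n (scale z (pow q m)) q + sumN k' (λ a → sumN (suc a) (convTerm (suc k') z m n a))
  G-convolution k' zero    n z = begin
    G k n z q                                    ≈⟨ *-identityˡ _ ⟨
    1# * G k n z q                               ≈⟨ *-cong (sym (G-zero k z)) (G-cong k n (λ i → sym (*-identityʳ (z i)))) ⟩
    G k 0 z q * G k n (scale z (pow q 0)) q      ≈⟨ +-identityʳ _ ⟨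
    G k 0 z q * G k n (scale z (pow q 0)) q + 0# ≈⟨ +-cong refl (sym (sumN-zero k' (λ a → sumN-zero (suc a) (λ b → noPrefix a b)))) ⟩
    G k 0 z q * G k n (scale z (pow q 0)) q + sumN k' (λ a → sumN (suc a) (convTerm k z 0 n a)) ∎
    where
    k = suc k'
    noPrefix : ∀ a b → convTerm k z 0 n a b ≈ 0#
    noPrefix a b = trans (*-cong refl (trans (*-cong refl (zeroˡ _)) (zeroʳ _))) (zeroʳ _)
  G-convolution k' (suc m) n z = begin
    G k (suc m +ℕ n) z q                   ≡⟨ ≡.cong (λ x → G k x z q) (≡.sym (ℕP.+-suc m n)) ⟩
    G k (m +ℕ suc n) z q                   ≈⟨ G-convolution k' m (suc n) z ⟩
    G k m z q * G k (suc n) (scale z (pow q m)) q + sumN k' (λ a → sumN (suc a) (convTerm k z m (suc n) a))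
      ≈⟨ +-cong (convolution-expandRight k' m n z) (sumN-cong k' (λ a → sumN-last a _)) ⟩
    (S + sumN k' U) + sumN k' (λ a → X a + V a)   ≈⟨ +-cong refl (sumN-+ k' X V) ⟩
    (S + sumN k' U) + (sumN k' X + sumN k' V)     ≈⟨ regroup S (sumN k' U) (sumN k' X) (sumN k' V) ⟩
    (S + sumN k' V) + (sumN k' U + sumN k' X)     ≈⟨ +-cong (sym (convolution-expandLeft k' m n z)) (sym (sumN-+ k' U X)) ⟩
    G k (suc m) z q * G k n (scale z (pow q (suc m))) q + sumN k' (λ a → U a + X a)
      ≈⟨ +-cong refl (sumN-cong k' (λ a → +-cong refl (sumN-cong a (λ b → reflexive (≡.cong (λ x → convTerm′ a b x) (≡.sym (ℕP.+-suc n (suc b)))))))) ⟩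
    G k (suc m) z q * G k n (scale z (pow q (suc m))) q + sumN k' (λ a → sumN (suc a) (convTerm k z (suc m) n a)) ∎
    where
    k = suc k'
    S = singletonSplit k z m n
    U X V : ℕ → Carrier
    U a = convTerm k z (suc m) n a 0
    X a = sumN a (convTerm k z m (suc n) a)
    V a = convTerm k z m (suc n) a a
    -- convTerm k z (suc m) n a (suc b) with the index of the second G left open
    convTerm′ : ℕ → ℕ → ℕ → Carrier
    convTerm′ a b x = z (suc (suc a)) * (pow q (m ∸ suc b)
      * (Gsub k m (suc b) z * Gsub k x (suc (suc a)) (scale z (pow q ((m +ℕ suc (suc a)) ∸ suc b)))))
    regroup : ∀ a b c d → (a + b) + (c + d) ≈ (a + d) + (b + c)
    regroup a b c d = trans (+-cong refl (+-comm c d)) (interchange a b d c)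

  G-convolutionℤ : ∀ k' m n z → G (suc k') (m +ℕ n) z q
    ≈ G (suc k') m z q * G (suc k') n (scale z (pow q m)) q
      + sumN k' (λ a → sumN (suc a) (λ b → z (2 +ℕ a) * (pow q (m ∸ suc b)
          * (Gℤ (suc k') (ℤ.+ m ℤ.- ℤ.+ suc b) z q
            * Gℤ (suc k') ((ℤ.+ n ℤ.- ℤ.+ (2 +ℕ a)) ℤ.+ ℤ.+ suc b) (scale z (pow q ((m +ℕ (2 +ℕ a)) ∸ suc b))) q))))
  G-convolutionℤ k' m n z = trans (G-convolution k' m n z) (+-cong refl (sumN-cong k' (λ a →
      sumN-cong (suc a) {convTerm k z m n a} {paperTerm a} (λ b → reflexive (paperForm a b)))))
    where
    k = suc k'
    w : ℕ → ℕ → ℕ → Carrier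
    w a b = scale z (pow q ((m +ℕ (2 +ℕ a)) ∸ suc b))
    paperTerm : ℕ → ℕ → Carrier
    paperTerm a b = z (2 +ℕ a) * (pow q (m ∸ suc b)
      * (Gℤ k (ℤ.+ m ℤ.- ℤ.+ suc b) z q * Gℤ k ((ℤ.+ n ℤ.- ℤ.+ (2 +ℕ a)) ℤ.+ ℤ.+ suc b) (w a b) q))
    index≡ : ∀ a b → (ℤ.+ n ℤ.- ℤ.+ (2 +ℕ a)) ℤ.+ ℤ.+ suc b ≡ ℤ.+ (n +ℕ suc b) ℤ.- ℤ.+ (2 +ℕ a)
    index≡ a b = ≡.trans (ℤP.+-assoc (ℤ.+ n) (ℤ.- ℤ.+ (2 +ℕ a)) (ℤ.+ suc b))
      (≡.trans (≡.cong (λ x → ℤ.+ n ℤ.+ x) (ℤP.+-comm (ℤ.- ℤ.+ (2 +ℕ a)) (ℤ.+ suc b)))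
               (≡.sym (ℤP.+-assoc (ℤ.+ n) (ℤ.+ suc b) (ℤ.- ℤ.+ (2 +ℕ a)))))
    paperForm : ∀ a b → convTerm k z m n a b ≡ paperTerm a b
    paperForm a b = ≡.cong₂ (λ x y → z (2 +ℕ a) * (pow q (m ∸ suc b) * (x * y)))
      (≡.sym (Gℤ≡Gsub k m (suc b) z))
      (≡.sym (≡.trans (≡.cong (λ i → Gℤ k i (w a b) q) (index≡ a b)) (Gℤ≡Gsub k (n +ℕ suc b) (2 +ℕ a) (w a b))))

  δ : ℕ → ℕ → Carrier
  δ zero    zero    = 1#
  δ zero    (suc d) = 0#
  δ (suc m) zero    = 0#
  δ (suc m) (suc d) = δ m d

  δ-< : ∀ n d → n < d → δ n d ≡ 0#
  δ-< zero    (suc d) _         = ≡.refl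
  δ-< (suc n) (suc d) (s≤s n<d) = δ-< n d n<d

  sum-δ : ∀ n e (h : ℕ → Carrier) → sumN (suc n) (λ j → h j * δ n (e +ℕ j)) ≈ (if e <ᵇ suc n then h (n ∸ e) else 0#)
  sum-δ n       zero    h = diagonal n h
    where
    diagonal : ∀ n (h : ℕ → Carrier) → sumN (suc n) (λ j → h j * δ n j) ≈ h n
    diagonal zero    h = trans (+-identityʳ _) (*-identityʳ _)
    diagonal (suc n) h = trans (+-cong (zeroʳ _) (diagonal n (λ j → h (suc j)))) (+-identityˡ _)
  sum-δ zero    (suc e) h = trans (+-identityʳ _) (zeroʳ _)
  sum-δ (suc n) (suc e) h = trans (sumN-last (suc n) (λ j → h j * δ n (e +ℕ j)))
    (trans (+-cong (sum-δ n e h) (trans (*-cong refl (reflexive (δ-< n (e +ℕ suc n) (ℕP.m≤n+m (suc n) e)))) (zeroʳ _)))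
           (+-identityʳ _))

  Gsub-byLastBlock : ∀ K m d w →
    Gsub K m d w ≈ δ m d + sumN K (λ a → Gsub K m (suc (a +ℕ d)) w * (w (suc a) * pow q (m ∸ suc (a +ℕ d))))
  Gsub-byLastBlock K zero    zero    w = trans (G-zero K w) (sym (trans (+-cong refl (sumN-zero K (λ a → zeroˡ _))) (+-identityʳ _)))
  Gsub-byLastBlock K (suc m) zero    w = trans (G-byLastBlock K m w) (trans (sumN-cong K (λ a → reflexive
    (≡.cong (λ x → Gsub K m x w * (w (suc a) * pow q (m ∸ x))) (≡.sym (ℕP.+-identityʳ a))))) (sym (+-identityˡ _)))
  Gsub-byLastBlock K zero    (suc d) w = sym (trans (+-identityˡ _) (sumN-zero K (λ a → zeroˡ _)))
  Gsub-byLastBlock K (suc m) (suc d) w = trans (Gsub-byLastBlock K m d w) (+-cong refl (sumN-cong K (λ a → reflexive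
    (≡.cong (λ x → Gsub K m x w * (w (suc a) * pow q (m ∸ x))) (≡.sym (ℕP.+-suc a d))))))

  Gsub-*-guard : ∀ K n d w {X Y} → (d ≤ n → X ≈ Y) → Gsub K n d w * X ≈ Gsub K n d w * Y
  Gsub-*-guard K n d w {X} {Y} X≈Y with d ≤? n
  ... | yes d≤n = *-cong refl (X≈Y d≤n)
  ... | no  d≰n = trans (*-cong (reflexive (Gsub-vanishes K n d w (ℕP.≰⇒> d≰n))) refl)
                        (trans (zeroˡ X) (sym (trans (*-cong (reflexive (Gsub-vanishes K n d w (ℕP.≰⇒> d≰n))) refl) (zeroˡ Y))))

  module _ (k' : ℕ) (z : ℕ → Carrier) where
    private
      k : ℕ
      k = suc k'
      -- the weights after a first k-block preceded by j elements
      w : ℕ → ℕ → Carrier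
      w j = scale z (pow q (k +ℕ j))
      lastBlock : ℕ → ℕ → Carrier
      lastBlock n a = z (suc a) * pow q (n ∸ a)

    -- refTerm n a j = z_k q^j G^{k−1}_j(z) G^k_{n−a−k−j}(z q^{k+j}): the layered
    -- partitions of [n−a] whose first k-block comes after j elements.
    refTerm : ℕ → ℕ → ℕ → Carrier
    refTerm n a j = z k * (pow q j * (G k' j z q * Gsub k n (a +ℕ (k +ℕ j)) (w j)))

    -- Removing the last block from the part after the first k-block.
    private
      afterLast : ℕ → ℕ → ℕ → Carrier
      afterLast n a j = Gsub k n (suc (a +ℕ (k' +ℕ j))) (w j) * (w j (suc a) * pow q (n ∸ suc (a +ℕ (k' +ℕ j))))

    refTerm-lastBlock : ∀ n a j → z k * (pow q j * (G k' j z q * afterLast n a j)) ≈ refTerm n a j * lastBlock n a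
    refTerm-lastBlock n a j = begin
      z k * (pow q j * (G k' j z q * (g * ((z (suc a) * pow q (k +ℕ j)) * pow q e))))
        ≈⟨ *-solve 7 (λ x y G' g za Q P → (x ⊕ (y ⊕ (G' ⊕ (g ⊕ ((za ⊕ Q) ⊕ P))))) ⊜ (g ⊕ (((x ⊕ y) ⊕ (G' ⊕ za)) ⊕ (Q ⊕ P)))) refl _ _ _ _ _ _ _ ⟩
      g * (((z k * pow q j) * (G k' j z q * z (suc a))) * (pow q (k +ℕ j) * pow q e))
        ≈⟨ Gsub-*-guard k n (suc (a +ℕ (k' +ℕ j))) (w j) (λ fits → *-cong refl (trans (sym (pow-+ q (k +ℕ j) e))
                                                                                      (reflexive (≡.cong (pow q) (exponent fits))))) ⟩
      g * (((z k * pow q j) * (G k' j z q * z (suc a))) * pow q (n ∸ a))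
        ≈⟨ *-solve 6 (λ x y G' g za P → (g ⊕ (((x ⊕ y) ⊕ (G' ⊕ za)) ⊕ P)) ⊜ ((x ⊕ (y ⊕ (G' ⊕ g))) ⊕ (za ⊕ P))) refl _ _ _ _ _ _ ⟩
      (z k * (pow q j * (G k' j z q * g))) * lastBlock n a
        ≡⟨ ≡.cong (λ x → (z k * (pow q j * (G k' j z q * Gsub k n x (w j)))) * lastBlock n a) (≡.sym (ℕP.+-suc a (k' +ℕ j))) ⟩
      refTerm n a j * lastBlock n a ∎
      where
      g = Gsub k n (suc (a +ℕ (k' +ℕ j))) (w j)
      e = n ∸ suc (a +ℕ (k' +ℕ j))
      exponent : suc (a +ℕ (k' +ℕ j)) ≤ n → (k +ℕ j) +ℕ e ≡ n ∸ a
      exponent fits = ≡.trans (≡.cong (λ x → (k +ℕ j) +ℕ (n ∸ x)) (≡.sym (ℕP.+-suc a (k' +ℕ j))))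
                              (∸-split n a (k +ℕ j) (≡.subst (_≤ n) (≡.sym (ℕP.+-suc a (k' +ℕ j))) fits))
        where
        ∸-split : ∀ n a b → a +ℕ b ≤ n → b +ℕ (n ∸ (a +ℕ b)) ≡ n ∸ a
        ∸-split n a b a+b≤n = ≡.trans (≡.cong (b +ℕ_) (≡.sym (ℕP.∸-+-assoc n a b)))
          (ℕP.m+[n∸m]≡n (ℕP.m+n≤o⇒m≤o∸n b (≡.subst (_≤ n) (ℕP.+-comm a b) a+b≤n)))

    -- The partitions of [n+1] whose first k-block comes after j elements:
    -- either that block is also the last one, or a last block follows.
    refTerm-split : ∀ n j → refTerm (suc n) 0 j
      ≈ z k * (pow q j * (G k' j z q * δ n (k' +ℕ j))) + sumN k (λ a → refTerm n a j * lastBlock n a)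
    refTerm-split n j = begin
      z k * (pow q j * (G k' j z q * Gsub k n (k' +ℕ j) (w j)))
        ≈⟨ *-cong refl (*-cong refl (*-cong refl (Gsub-byLastBlock k n (k' +ℕ j) (w j)))) ⟩
      z k * (pow q j * (G k' j z q * (δ n (k' +ℕ j) + sumN k ((λ a → afterLast n a j)))))
        ≈⟨ trans (*-cong refl (trans (*-cong refl (distribˡ _ _ _)) (distribˡ _ _ _))) (distribˡ _ _ _) ⟩
      z k * (pow q j * (G k' j z q * δ n (k' +ℕ j))) + z k * (pow q j * (G k' j z q * sumN k ((λ a → afterLast n a j))))
        ≈⟨ +-cong refl (trans (*-cong refl (trans (*-cong refl (sumN-*ˡ k (G k' j z q) ((λ a → afterLast n a j))))
                                                (sumN-*ˡ k (pow q j) (λ a → G k' j z q * afterLast n a j))))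
                              (sumN-*ˡ k (z k) (λ a → pow q j * (G k' j z q * afterLast n a j)))) ⟩
      z k * (pow q j * (G k' j z q * δ n (k' +ℕ j))) + sumN k (λ a → z k * (pow q j * (G k' j z q * afterLast n a j)))
        ≈⟨ +-cong refl (sumN-cong k {λ a → z k * (pow q j * (G k' j z q * afterLast n a j))}
                                    {λ a → refTerm n a j * lastBlock n a} (λ a → refTerm-lastBlock n a j)) ⟩
      z k * (pow q j * (G k' j z q * δ n (k' +ℕ j))) + sumN k (λ a → refTerm n a j * lastBlock n a) ∎

    -- When the first k-block is also the last block, it is a last block of
    -- size k after the n+1−k elements of a G^{k−1}-partition.
    refinement-lastIsFirst : ∀ n → sumN (suc n) (λ j → z k * (pow q j * (G k' j z q * δ n (k' +ℕ j))))
                                  ≈ Gsub k' n k' z * lastBlock n k'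
    refinement-lastIsFirst n = begin
      sumN (suc n) (λ j → z k * (pow q j * (G k' j z q * δ n (k' +ℕ j))))
        ≈⟨ sumN-cong (suc n) {λ j → z k * (pow q j * (G k' j z q * δ n (k' +ℕ j)))} {λ j → h j * δ n (k' +ℕ j)}
                     (λ j → trans (*-cong refl (sym (*-assoc _ _ _))) (sym (*-assoc _ _ _))) ⟩
      sumN (suc n) (λ j → h j * δ n (k' +ℕ j))                ≈⟨ sum-δ n k' h ⟩
      (if k' <ᵇ suc n then h (n ∸ k') else 0#)
        ≈⟨ if-cong (k' <ᵇ suc n) (*-solve 3 (λ x y G' → (x ⊕ (y ⊕ G')) ⊜ (G' ⊕ (x ⊕ y))) refl (z k) (pow q (n ∸ k')) (G k' (n ∸ k') z q)) ⟩
      (if k' <ᵇ suc n then G k' (n ∸ k') z q * lastBlock n k' else 0#) ≈⟨ if-* (k' <ᵇ suc n) _ _ ⟨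
      (if k' <ᵇ suc n then G k' (n ∸ k') z q else 0#) * lastBlock n k' ≈⟨ *-cong (Gsub-guarded k' n k' z) refl ⟨
      Gsub k' n k' z * lastBlock n k'                         ∎
      where
      h : ℕ → Carrier
      h j = z k * (pow q j * G k' j z q)

    refinement-terms : ∀ n → sumN (suc (suc n)) (refTerm (suc n) 0)
      ≈ Gsub k' n k' z * lastBlock n k' + sumN (suc n) (λ j → sumN k (λ a → refTerm n a j * lastBlock n a))
    refinement-terms n = begin
      sumN (suc (suc n)) (refTerm (suc n) 0)          ≈⟨ sumN-last (suc n) (refTerm (suc n) 0) ⟩
      sumN (suc n) (refTerm (suc n) 0) + refTerm (suc n) 0 (suc n)
        ≈⟨ trans (+-cong refl tooLate) (+-identityʳ _) ⟩
      sumN (suc n) (refTerm (suc n) 0)                ≈⟨ sumN-cong (suc n) (refTerm-split n) ⟩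
      sumN (suc n) (λ j → lastIsFirst j + sumN k (λ a → refTerm n a j * lastBlock n a))
        ≈⟨ sumN-+ (suc n) lastIsFirst (λ j → sumN k (λ a → refTerm n a j * lastBlock n a)) ⟩
      sumN (suc n) lastIsFirst + sumN (suc n) (λ j → sumN k (λ a → refTerm n a j * lastBlock n a))
        ≈⟨ +-cong (refinement-lastIsFirst n) refl ⟩
      Gsub k' n k' z * lastBlock n k' + sumN (suc n) (λ j → sumN k (λ a → refTerm n a j * lastBlock n a)) ∎
      where
      lastIsFirst : ℕ → Carrier
      lastIsFirst j = z k * (pow q j * (G k' j z q * δ n (k' +ℕ j)))
      -- a first k-block after n+1 elements does not fit into [n+1]
      tooLate : refTerm (suc n) 0 (suc n) ≈ 0#
      tooLate = trans (*-cong refl (*-cong refl (*-cong refl (reflexive (Gsub-vanishes k n (k' +ℕ suc n) (w (suc n)) (ℕP.m≤n+m (suc n) k'))))))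
                      (zeroʳ³ _ _ _)

    -- The induction step, removing the last block on both sides.
    refinement-step : ∀ n → (∀ a → Gsub k n a z ≈ Gsub k' n a z + sumN (suc n) (refTerm n a)) →
                      G k (suc n) z q ≈ G k' (suc n) z q + sumN (suc (suc n)) (refTerm (suc n) 0)
    refinement-step n IH = begin
      G k (suc n) z q                                       ≈⟨ G-byLastBlock k n z ⟩
      sumN k (λ a → Gsub k n a z * lastBlock n a)           ≈⟨ sumN-cong k {λ a → Gsub k n a z * lastBlock n a} {λ a → A a + B a} expand ⟩
      sumN k (λ a → A a + B a)                              ≈⟨ sumN-+ k A B ⟩
      sumN k A + sumN k B                                   ≈⟨ +-cong (sumN-last k' A) (sumN-swap k (suc n) (λ a j → refTerm n a j * lastBlock n a)) ⟩
      (sumN k' A + A k') + sumN (suc n) (λ j → sumN k (λ a → refTerm n a j * lastBlock n a))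
        ≈⟨ +-cong (+-cong (G-byLastBlock k' n z) refl) refl ⟨
      (G k' (suc n) z q + A k') + sumN (suc n) (λ j → sumN k (λ a → refTerm n a j * lastBlock n a))
        ≈⟨ +-assoc _ _ _ ⟩
      G k' (suc n) z q + (A k' + sumN (suc n) (λ j → sumN k (λ a → refTerm n a j * lastBlock n a)))
        ≈⟨ +-cong refl (refinement-terms n) ⟨
      G k' (suc n) z q + sumN (suc (suc n)) (refTerm (suc n) 0) ∎
      where
      A B : ℕ → Carrier
      A a = Gsub k' n a z * lastBlock n a
      B a = sumN (suc n) (λ j → refTerm n a j * lastBlock n a)
      expand : ∀ a → Gsub k n a z * lastBlock n a ≈ A a + B a
      expand a = trans (*-cong (IH a) refl) (trans (distribʳ _ _ _) (+-cong refl (sumN-*ʳ (suc n) (lastBlock n a) (refTerm n a))))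

    Gsub-refinement : ∀ n a → Gsub k n a z ≈ Gsub k' n a z + sumN (suc n) (refTerm n a)
    Gsub-refinement zero    zero    = trans (G-zero k z) (sym (trans (+-cong (G-zero k' z) (trans (+-identityʳ _) noRoom))
                                                                     (+-identityʳ 1#)))
      where
      noRoom : refTerm 0 0 0 ≈ 0#
      noRoom = zeroʳ³ _ _ _
    Gsub-refinement zero    (suc a) = sym (trans (+-identityˡ _) (trans (+-identityʳ _) noRoom))
      where
      noRoom : refTerm 0 (suc a) 0 ≈ 0#
      noRoom = zeroʳ³ _ _ _
    Gsub-refinement (suc n) zero    = refinement-step n (Gsub-refinement n)
    Gsub-refinement (suc n) (suc a) = trans (Gsub-refinement n a) (+-cong refl (sym (trans (sumN-last (suc n) (refTerm n a))
      (trans (+-cong refl tooLate) (+-identityʳ _)))))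
      where
      tooLate : refTerm n a (suc n) ≈ 0#
      tooLate = trans (*-cong refl (*-cong refl (*-cong refl (reflexive (Gsub-vanishes k n (a +ℕ (k +ℕ suc n)) (w (suc n))
                       (ℕP.≤-trans (ℕP.m≤n+m (suc n) k) (ℕP.m≤n+m _ a)))))))
                      (zeroʳ³ _ _ _)

    G-refinement : ∀ n → G k n z q ≈ G k' n z q
      + sumN (n ∸ k') (λ j → z k * (pow q j * (G k' j z q * G k (n ∸ (k +ℕ j)) (w j) q)))
    G-refinement n = trans (Gsub-refinement n 0) (+-cong refl (sym (sumN-extend (n ∸ k') (suc n)
      (ℕP.≤-trans (ℕP.m∸n≤m n k') (ℕP.n≤1+n n)) inRange outOfRange)))
      where
      fits : ∀ n k' j → j < n ∸ k' → suc k' +ℕ j ≤ n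
      fits n       zero     j j<n      = j<n
      fits (suc n) (suc k') j j<n∸k'   = s≤s (fits n k' j j<n∸k')
      tooLate : ∀ n k' j → n ∸ k' ≤ j → n < suc k' +ℕ j
      tooLate n       zero     j n≤j    = s≤s n≤j
      tooLate zero    (suc k') j _      = s≤s z≤n
      tooLate (suc n) (suc k') j n∸k'≤j = s≤s (tooLate n k' j n∸k'≤j)
      inRange : ∀ j → j < n ∸ k' → z k * (pow q j * (G k' j z q * G k (n ∸ (k +ℕ j)) (w j) q)) ≈ refTerm n 0 j
      inRange j j<n∸k' = *-cong refl (*-cong refl (*-cong refl (reflexive (≡.sym (Gsub-≤ k n (k +ℕ j) (w j) (fits n k' j j<n∸k'))))))
      outOfRange : ∀ j → n ∸ k' ≤ j → refTerm n 0 j ≈ 0#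
      outOfRange j n∸k'≤j = trans (*-cong refl (*-cong refl (*-cong refl
        (reflexive (Gsub-vanishes k n (k +ℕ j) (w j) (tooLate n k' j n∸k'≤j)))))) (zeroʳ³ _ _ _)

  -- With N = n + k − 1 the matrix is
  -- M_{s,t} = G_{N+t−s}(w q^s) for s, t < k; expanding its first row by the
  -- first-block recursion and clearing rows gives M(N+1, w) ~ M(N, w q).
  module _ (k' : ℕ) where
    private
      k : ℕ
      k = suc k'

    shiftedRow : ℕ → (ℕ → Carrier) → ℕ → Fin k → Carrier
    shiftedRow N w a t = Gsub k (N +ℕ toℕ t) a (scale w (pow q a))

    shiftMatrix : ℕ → (ℕ → Carrier) → Matrix k k
    shiftMatrix N w s t = shiftedRow N w (toℕ s) t

    snocRow-shifts : ∀ {m} {a} {X : Set a} (row : ℕ → X) (s : Fin (suc m)) → snocRow (λ i → row (toℕ i)) (row m) s ≡ row (toℕ s)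
    snocRow-shifts {zero}  row zero    = ≡.refl
    snocRow-shifts {suc m} row zero    = ≡.refl
    snocRow-shifts {suc m} row (suc s) = snocRow-shifts (λ x → row (suc x)) s

    shiftDet-step : ∀ N w → det k (shiftMatrix (suc N) w) ≈ w k * (pow (- 1#) k' * det k (shiftMatrix N (scale w q)))
    shiftDet-step N w = begin
      det k (shiftMatrix (suc N) w)                      ≈⟨ det-cong k rows≈ ⟩
      det k (consRow firstRow laterRows)                 ≈⟨ det-linear k' k (λ a → w (suc a)) (shiftedRow N w′) laterRows ⟩
      sumN k (λ a → w (suc a) * det k (consRow (shiftedRow N w′ a) laterRows))
        ≈⟨ sumN-last k' (λ a → w (suc a) * det k (consRow (shiftedRow N w′ a) laterRows)) ⟩
      sumN k' (λ a → w (suc a) * det k (consRow (shiftedRow N w′ a) laterRows)) + w k * det k (consRow (shiftedRow N w′ k') laterRows)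
        ≈⟨ +-cong (trans (sumN-cong< k' {λ a → w (suc a) * det k (consRow (shiftedRow N w′ a) laterRows)} {λ _ → 0#} repeated)
                         (sumN-zero k' (λ _ → refl)))
                  (*-cong refl (det-rotate k' (shiftedRow N w′ k') laterRows)) ⟩
      0# + w k * (pow (- 1#) k' * det k (snocRow laterRows (shiftedRow N w′ k')))
        ≈⟨ +-identityˡ _ ⟩
      w k * (pow (- 1#) k' * det k (snocRow laterRows (shiftedRow N w′ k')))
        ≈⟨ *-cong refl (*-cong refl (det-cong k (λ r s → reflexive (≡.cong (λ row → row s) (snocRow-shifts (shiftedRow N w′) r))))) ⟩
      w k * (pow (- 1#) k' * det k (shiftMatrix N w′)) ∎
      where
      w′ = scale w q
      laterRows : Matrix k' k
      laterRows i = shiftedRow N w′ (toℕ i)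
      firstRow : Fin k → Carrier
      firstRow t = sumN k (λ a → w (suc a) * shiftedRow N w′ a t)
      scale-suc : ∀ a i → scale w (pow q (suc a)) i ≈ scale w′ (pow q a) i
      scale-suc a i = sym (*-assoc _ _ _)
      rows≈ : ∀ r t → shiftMatrix (suc N) w r t ≈ consRow firstRow laterRows r t
      rows≈ zero    t = trans (G-cong k (suc (N +ℕ toℕ t)) (λ i → *-identityʳ (w i))) (trans (G-byFirstBlock k (N +ℕ toℕ t) w)
        (sumN-cong k {λ a → w (suc a) * Gsub k (N +ℕ toℕ t) a (scale w (pow q (suc a)))} {λ a → w (suc a) * shiftedRow N w′ a t}
                     (λ a → *-cong refl (Gsub-cong k (N +ℕ toℕ t) a (scale-suc a)))))
      rows≈ (suc i) t = Gsub-cong k (N +ℕ toℕ t) (toℕ i) (scale-suc (toℕ i))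
      -- all but the last term repeat one of the later rows
      repeated : ∀ a → a < k' → w (suc a) * det k (consRow (shiftedRow N w′ a) laterRows) ≈ 0#
      repeated a a<k' = trans (*-cong refl (trans (det-cong k {consRow (shiftedRow N w′ a) laterRows} {consRow (laterRows (fromℕ< a<k')) laterRows} same)
                                                 (det-repeated-row k' laterRows (fromℕ< a<k')))) (zeroʳ _)
        where
        same : ∀ r t → consRow (shiftedRow N w′ a) laterRows r t ≈ consRow (laterRows (fromℕ< a<k')) laterRows r t
        same zero    t = reflexive (≡.cong (λ x → shiftedRow N w′ x t) (≡.sym (FinP.toℕ-fromℕ< a<k')))
        same (suc r) t = refl

    -- For N = 0 the matrix is unitriangular: G_{t−s} vanishes below the diagonal.
    shiftDet-base : ∀ w → det k (shiftMatrix 0 w) ≈ 1#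
    shiftDet-base w = det-unitriangular k (shiftMatrix 0 w)
      (λ r s s<r → reflexive (Gsub-vanishes k (toℕ s) (toℕ r) (scale w (pow q (toℕ r))) s<r))
      (λ r → trans (reflexive (Gsub-diag k 0 (toℕ r) (scale w (pow q (toℕ r))))) (G-zero k (scale w (pow q (toℕ r)))))

    shiftDet : ∀ N w → det k (shiftMatrix N w) ≈ pow (pow (- 1#) k' * w k) N * pow q (N C 2)
    shiftDet zero    w = trans (shiftDet-base w) (sym (*-identityˡ 1#))
    shiftDet (suc N) w = begin
      det k (shiftMatrix (suc N) w)                          ≈⟨ shiftDet-step N w ⟩
      w k * (σ * det k (shiftMatrix N (scale w q)))          ≈⟨ *-cong refl (*-cong refl (shiftDet N (scale w q))) ⟩
      w k * (σ * (pow (σ * (w k * q)) N * pow q (N C 2)))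
        ≈⟨ *-cong refl (*-cong refl (*-cong (trans (pow-cong N (sym (*-assoc _ _ _))) (pow-*-distrib (σ * w k) q N)) refl)) ⟩
      w k * (σ * ((P * pow q N) * pow q (N C 2)))
        ≈⟨ *-solve 5 (λ x e P Q S → (x ⊕ (e ⊕ ((P ⊕ Q) ⊕ S))) ⊜ (((e ⊕ x) ⊕ P) ⊕ (Q ⊕ S))) refl _ _ _ _ _ ⟩
      ((σ * w k) * P) * (pow q N * pow q (N C 2))            ≈⟨ *-cong refl (trans (sym (pow-+ q N (N C 2))) (reflexive (≡.cong (pow q) (≡.sym (sucN-C-2 N))))) ⟩
      pow (σ * w k) (suc N) * pow q (suc N C 2)              ∎
      where
      σ = pow (- 1#) k'
      P = pow (σ * w k) N
      sucN-C-2 : ∀ N → suc N C 2 ≡ N +ℕ N C 2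
      sucN-C-2 N = ≡.trans (≡.sym (nCk+nC[k+1]≡[n+1]C[k+1] N 1)) (≡.cong (_+ℕ N C 2) (nC1≡n N))

    G-determinant : ∀ n z → 1 ≤ n →
      det k (λ s t → G k ((n +ℕ k' +ℕ toℕ t) ∸ toℕ s) (scale z (pow q (toℕ s))) q)
      ≈ (if k % 2 ≡ᵇ 1
           then pow (z k) (n +ℕ k') * pow q ((n +ℕ k') C 2)
           else pow (- 1#) (n ∸ 1) * (pow (z k) (n +ℕ k') * pow q ((n +ℕ k') C 2)))
    G-determinant (suc n') z _ = begin
      det k (λ s t → G k ((N +ℕ toℕ t) ∸ toℕ s) (scale z (pow q (toℕ s))) q) ≈⟨ det-cong k entries ⟩
      det k (shiftMatrix N z)                                               ≈⟨ shiftDet N z ⟩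
      pow (pow (- 1#) k' * z k) N * pow q (N C 2)                           ≈⟨ *-cong (alternating-power k' n' (z k)) refl ⟩
      (if k % 2 ≡ᵇ 1 then pow (z k) N else pow (- 1#) n' * pow (z k) N) * pow q (N C 2)
                                                                            ≈⟨ if-*-assoc (k % 2 ≡ᵇ 1) _ _ _ ⟩
      (if k % 2 ≡ᵇ 1 then pow (z k) N * pow q (N C 2) else pow (- 1#) n' * (pow (z k) N * pow q (N C 2))) ∎
      where
      N = suc n' +ℕ k'
      entries : ∀ s t → G k ((N +ℕ toℕ t) ∸ toℕ s) (scale z (pow q (toℕ s))) q ≈ shiftMatrix N z s t
      entries s t = reflexive (≡.sym (Gsub-≤ k (N +ℕ toℕ t) (toℕ s) _
        (ℕP.≤-trans (ℕP.≤-pred (FinP.toℕ<n s)) (ℕP.≤-trans (ℕP.m≤n+m k' (suc n')) (ℕP.m≤m+n N (toℕ t))))))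
      if-*-assoc : ∀ (b : Bool) X E Z → (if b then X else E * X) * Z ≈ (if b then X * Z else E * (X * Z))
      if-*-assoc true  X E Z = refl
      if-*-assoc false X E Z = *-assoc _ _ _

-- Notation of the statement (imported here since `+_` clashes with sections of `_+_` above).
open import Data.Nat.Combinatorics using (_C_)
open import Data.Integer using (+_) renaming (_-_ to _-ℤ_; _+_ to _+ℤ_)
open import Data.Fin using (Fin; toℕ)
open import Data.Product using (_×_; _,_)
open import Data.Bool using (if_then_else_)
open import Data.Nat using (_%_; _≡ᵇ_)

mainTheorem16 : ∀ {c ℓ} (R : CommutativeRing c ℓ) (k : ℕ) → 1 ≤ k →
    (z : ℕ → CommutativeRing.Carrier R) (q : CommutativeRing.Carrier R) →
    let open CommutativeRing R
        open WithRing R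
    in
    -- G_0^k = 1
    (G k 0 z q ≈ 1#)
    -- G_n^k(z) = Σ_{i=1}^k z_i G_{n-i}^k(z q^i)
    × (∀ n → 1 ≤ n →
         G k n z q ≈ sumN k (λ a → z (suc a) * Gℤ k (+ n -ℤ + suc a) (scale z (pow q (suc a))) q))
    -- G_{m+n}^k(z) = G_m(z) G_n(z q^m)
    --   + Σ_{i=2}^k Σ_{j=1}^{i-1} z_i q^{m-j} G_{m-j}(z) G_{n-i+j}(z q^{m+i-j})
    × (∀ m n → 1 ≤ m → 1 ≤ n →
         G k (m +ℕ n) z q ≈
           G k m z q * G k n (scale z (pow q m)) q
           + sumN (k ∸ 1) (λ a → sumN (suc a) (λ b →
               z (2 +ℕ a) * (pow q (m ∸ suc b)
                 * (Gℤ k (+ m -ℤ + suc b) z q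
                   * Gℤ k ((+ n -ℤ + (2 +ℕ a)) +ℤ + suc b)
                          (scale z (pow q ((m +ℕ (2 +ℕ a)) ∸ suc b))) q)))))
    -- G_n^k(z) = G_n^{k-1}(z) + Σ_{j=0}^{n-k} z_k q^j G_j^{k-1}(z) G_{n-k-j}^k(z q^{k+j})
    × (∀ n → 1 ≤ n →
         G k n z q ≈
           G (k ∸ 1) n z q
           + sumN (suc n ∸ k) (λ j →
               z k * (pow q j * (G (k ∸ 1) j z q * G k (n ∸ (k +ℕ j)) (scale z (pow q (k +ℕ j))) q))))
    -- det [ G^k_{n+k-1+t-s}(z q^{s-1}) ]_{s,t=1..k}
    --   = z_k^{n+k-1} q^{C(n+k-1,2)}            (k odd)
    --   = (-1)^{n-1} z_k^{n+k-1} q^{C(n+k-1,2)} (k even)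
    × (∀ n → 1 ≤ n →
         det k (λ s t → G k ((n +ℕ (k ∸ 1) +ℕ toℕ t) ∸ toℕ s) (scale z (pow q (toℕ s))) q)
         ≈ (if k % 2 ≡ᵇ 1
              then pow (z k) (n +ℕ (k ∸ 1)) * pow q ((n +ℕ (k ∸ 1)) C 2)
              else pow (- 1#) (n ∸ 1) * (pow (z k) (n +ℕ (k ∸ 1)) * pow q ((n +ℕ (k ∸ 1)) C 2))))
mainTheorem16 R (suc k') (s≤s z≤n) z q =
    G-zero (suc k') z
  , (λ n 1≤n → G-recurrence (suc k') n z 1≤n)
  , (λ m n _ _ → G-convolutionℤ k' m n z)
  , (λ n _ → G-refinement k' z n)
  , (λ n 1≤n → G-determinant k' n z 1≤n)
  where open GeneratingFunction R q
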